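{- Let $k$ be a natural number and $L\subseteq 2^{<\omega}$. (a) If $L^\infty$ is $\check D_k(\mathbf{\Sigma}^0_1)$-complete, then $L_0^\infty$ is $D_{k+1}(\mathbf{\Sigma}^0_1)$-complete. (b) If $L^\infty$ is $\check D_{2k}(\mathbf{\Sigma}^0_1)$-complete, then $L_1^\infty$ is $\check D_{2k+1}(\mathbf{\Sigma}^0_1)$-complete. (c) If $L^\infty$ is $\check D_{2k}(\mathbf{\Sigma}^0_1)$-complete, then $L_2^\infty$ is $\check D_{2k+2}(\mathbf{\Sigma}^0_1)$-complete. (d) If $L^\infty$ is complete for $D_{2k+1}(\mathbf{\Sigma}^0_1)\oplus\check D_{2k+1}(\mathbf{\Sigma}^0_1)$, then $L_2^\infty$ is complete for $D_{2k+3}(\mathbf{\Sigma}^0_1)\oplus\check D_{2k+3}(\mathbf{\Sigma}^0_1)$. Here $L_0:=\{w\in 2^{<\omega}\mid |w| \text{ even},\ (w)_0\in L^*,\ (0\subseteq (w)_1 \text{ or } \exists q\in\omega\ 10^q1\subseteq (w)_1)\}$, $L_1:=\{w\in 2^{<\omega}\mid |w| \text{ even},\ (w)_0\in L^*,\ (w)_1\subseteq 0^\infty\}$, $L_2:=\{w\in 2^{<\omega}\mid |w| \text{ even},\ (w)_0\in L^*,\ ((w)_1\subseteq 0^\infty \text{ or } \exists p,q\in\omega\ 0^p10^q1\subseteq (w)_1)\}$.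
   Context: $2^{<\omega}$ is the set of finite binary words, $2^\omega$ the Cantor space. For $w\in 2^{<\omega}$ of even length $2l$ and $\varepsilon\in\{0,1\}$, $(w)_\varepsilon:=(w(\varepsilon),w(\varepsilon+2),\dots,w(\varepsilon+2l-2))$ (positions indexed from $0$). $L^*:=\{w_1\cdots w_l\mid l\in\omega,\ w_i\in L\}$. $v\subseteq u$ means $v$ is a prefix of $u$; $v\subseteq 0^\infty$ means $v$ consists only of $0$'s. The $\omega$-power of $M\subseteq 2^{<\omega}$ is $M^\infty:=\{\alpha\in 2^\omega\mid \alpha=w_0w_1w_2\cdots \text{ with all } w_i\in M\}$. $\mathbf{\Sigma}^0_1(X)$ is the class of open subsets of a Polish space $X$; $\check{\mathbf{\Gamma}}$ denotes complements. For a natural number $\zeta$ and an increasing sequence $O=(O_\eta)_{\eta<\zeta}$ of subsets of $X$, $D_\zeta(O):=\{x\in X\mid \exists \eta<\zeta\ (\mathrm{parity}(\eta)\neq\mathrm{parity}(\zeta)\wedge x\in O_\eta\setminus\bigcup_{\theta<\eta}O_\theta)\}$, $D_\zeta(\mathbf{\Gamma})(X)$ is the class of such sets with all $O_\eta\in\mathbf{\Gamma}(X)$, and $\check D_\zeta(\mathbf{\Gamma})$ the class of their complements. $(\mathbf{\Gamma}\oplus\mathbf{\Lambda})(X):=\{(A\cap C)\cup(B\setminus C)\mid C \text{ clopen},\ A\in\mathbf{\Gamma}(X),\ B\in\mathbf{\Lambda}(X)\}$. A set $A\subseteq 2^\omega$ is $\mathbf{\Gamma}$-complete if $A\in\mathbf{\Gamma}(2^\omega)$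 and every $B\in\mathbf{\Gamma}(2^\omega)$ equals $f^{ -1}(A)$ for some continuous $f:2^\omega\to 2^\omega$. -}

module Defs where

open import Level using (0ℓ)
open import Data.Bool using (Bool; true; false)
open import Data.Nat using (ℕ; zero; suc; _<_; _≤_; _%_; _*_)
open import Data.List using (List; []; _∷_; _++_; concat; length; replicate)
open import Data.List.Relation.Unary.All using (All)
open import Data.Product using (Σ; ∃; ∃-syntax; _×_; _,_)
open import Data.Sum using (_⊎_)
open import Data.Unit using (⊤)
open import Relation.Nullary using (¬_)
open import Relation.Binary.PropositionalEquality using (_≡_; _≢_)
open import Function.Bundles using (_⇔_)

-- Cantor space 2^ω, finite words 2^{<ω}  (0 = false, 1 = true)

Cantor : Set
Cantor = ℕ → Bool

Word : Set
Word = List Bool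

Pred : Set₁
Pred = Cantor → Set

Lang : Set₁
Lang = Word → Set

Class : Set₂
Class = Pred → Set₁

Agree : ℕ → Cantor → Cantor → Set
Agree n α β = ∀ i → i < n → α i ≡ β i

Open : Pred → Set
Open U = ∀ α → U α → ∃[ n ] (∀ β → Agree n α β → U β)

Clopen : Pred → Set
Clopen C = Open C × Open (λ x → ¬ C x)

Continuous : (Cantor → Cantor) → Set
Continuous f = ∀ α n → ∃[ m ] (∀ β → Agree m α β → Agree n (f α) (f β))

_≐_ : Pred → Pred → Set
A ≐ B = ∀ x → A x ⇔ B x

-- Difference hierarchy D_ζ(Σ⁰₁), ζ a natural number.
-- A sequence (O_η)_{η<ζ} is given as a function ℕ → Pred whose values
-- at indices ≥ ζ are irrelevant.

Increasing : ℕ → (ℕ → Pred) → Set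
Increasing ζ O = ∀ θ η → θ ≤ η → η < ζ → ∀ x → O θ x → O η x

Dset : ℕ → (ℕ → Pred) → Pred
Dset ζ O x =
  ∃[ η ] (η < ζ × (η % 2 ≢ ζ % 2) × O η x × (∀ θ → θ < η → ¬ O θ x))

D : ℕ → Class
D ζ A = ∃[ O ] ((∀ η → η < ζ → Open (O η)) × Increasing ζ O × (A ≐ Dset ζ O))

Dˇ : ℕ → Class
Dˇ ζ A = ∃[ B ] (D ζ B × (A ≐ (λ x → ¬ B x)))

_⊕_ : Class → Class → Class
(Γ ⊕ Λ) A = ∃[ C ] ∃[ A′ ] ∃[ B′ ]
  (Clopen C × Γ A′ × Λ B′ × (A ≐ (λ x → (A′ x × C x) ⊎ (B′ x × ¬ C x))))

Complete : Class → Pred → Set₁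
Complete Γ A = Γ A × (∀ B → Γ B → ∃[ f ] (Continuous f × (∀ x → B x ⇔ A (f x))))

_⊑_ : Word → Word → Set
v ⊑ u = ∃[ r ] (v ++ r ≡ u)

_≺_ : Word → Cantor → Set
[] ≺ α = ⊤
(b ∷ w) ≺ α = (b ≡ α 0) × (w ≺ (λ i → α (suc i)))

Star : Lang → Lang
Star L w = ∃[ ws ] (All L ws × concat ws ≡ w)

concatFirst : (ℕ → Word) → ℕ → Word
concatFirst ws zero = []
concatFirst ws (suc n) = concatFirst ws n ++ ws n

-- ω-power M^∞: α is the infinite concatenation w_0 w_1 w_2 ⋯ with w_i ∈ M
OmegaPower : Lang → Pred
OmegaPower M α = ∃[ ws ]
  ((∀ i → M (ws i)) × (∀ n → concatFirst ws n ≺ α)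
   × (∀ m → ∃[ n ] (m ≤ length (concatFirst ws n))))

evens : Word → Word
odds : Word → Word
evens [] = []
evens (a ∷ w) = a ∷ odds w
odds [] = []
odds (a ∷ w) = evens w

EvenLength : Word → Set
EvenLength w = length w % 2 ≡ 0

Zeros : Word → Set
Zeros v = All (_≡ false) v

one0q1 : ℕ → Word
one0q1 q = true ∷ (replicate q false ++ (true ∷ []))

L₀ : Lang → Lang
L₀ L w = EvenLength w × Star L (evens w)
  × (((false ∷ []) ⊑ odds w) ⊎ (∃[ q ] (one0q1 q ⊑ odds w)))

L₁ : Lang → Lang
L₁ L w = EvenLength w × Star L (evens w) × Zeros (odds w)

L₂ : Lang → Lang
L₂ L w = EvenLength w × Star L (evens w)
  × (Zeros (odds w) ⊎ (∃[ p ] ∃[ q ] ((replicate p false ++ one0q1 q) ⊑ odds w)))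

-- classical logic (the paper's ambient metatheory)
Classical : Set₁
Classical = (P : Set) → P ⊎ ¬ P

-- A point α lies in Lᵢ^∞ exactly when its even half (α)₀ lies in L^∞ and its odd half (α)₁ lies
-- in a fixed set Qᵢ: Q₀ ((α)₁ starts with 0 or has a 1 after position 0) is open, Q₁ = {0^ω} is
-- closed, and Q₂ (0^ω or at least two 1s) is the complement of U ∖ V for open sets V ⊆ U.
-- A D_ζ(Σ⁰₁) set is a parity condition on a rank r : 2^ω → {0, …, ζ} with open sublevel sets;
-- intersecting with Qᵢ(odd half) moves such a rank up by one or two levels, which bounds the
-- complexity of Lᵢ^∞. Conversely, reading off the top levels of the rank splits every set B of
-- the target class as A ∩ P with A in the source class and P open, closed, or the complement of
-- an (open ∖ open) set. Reducing A to L^∞ by hypothesis and P to Qᵢ by a Lipschitz map, the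
-- interleaving of the two reductions reduces B to Lᵢ^∞.

module Submission where

open import Defs
open import Data.Bool using (Bool; true; false; _∧_; _∨_; not)
open import Data.Bool.Properties using (∨-zeroʳ; ¬-not)
open import Data.Empty using (⊥; ⊥-elim)
open import Data.List using (List; []; _∷_; _++_; concat; length; replicate)
open import Data.List.Properties
  using (++-assoc; length-++; ++-identityʳ; ++-cancelʳ; length-replicate; concat-++)
open import Data.List.Relation.Unary.All using (All; []; _∷_)
open import Data.List.Relation.Unary.All.Properties using (++⁺)
open import Data.Nat using (ℕ; zero; suc; pred; _+_; _*_; _∸_; _≤_; _<_; z≤n; s≤s; _%_; _≟_; _≤?_; _<?_; _⊓_)
open import Data.Nat.Properties
open import Data.Product using (Σ; ∃-syntax; _×_; _,_; proj₁; proj₂)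
open import Data.Sum using (_⊎_; inj₁; inj₂; [_,_])
open import Data.Unit using (⊤; tt)
open import Function.Bundles using (_⇔_; mk⇔; Equivalence)
open import Function.Properties.Equivalence using () renaming (refl to ⇔-refl; sym to ⇔-sym; trans to ⇔-trans)
open import Data.Product.Function.NonDependent.Propositional using (_×-⇔_)
open import Relation.Nullary using (¬_; yes; no)
open import Relation.Nullary.Decidable using (decidable-stable)
open import Relation.Binary.PropositionalEquality hiding ([_])

to : ∀ {A B : Set} → A ⇔ B → A → B
to = Equivalence.to

from : ∀ {A B : Set} → A ⇔ B → B → A
from = Equivalence.from

shift : ℕ → Cantor → Cantor
shift n α i = α (n + i)

prefix : Cantor → ℕ → Word
prefix α zero = []
prefix α (suc n) = α 0 ∷ prefix (λ i → α (suc i)) n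

length-prefix : ∀ α n → length (prefix α n) ≡ n
length-prefix α zero = refl
length-prefix α (suc n) = cong suc (length-prefix _ n)

prefix-≺ : ∀ α n → prefix α n ≺ α
prefix-≺ α zero = tt
prefix-≺ α (suc n) = refl , prefix-≺ (λ i → α (suc i)) n

≺⇒≡prefix : ∀ w {α} → w ≺ α → w ≡ prefix α (length w)
≺⇒≡prefix [] p = refl
≺⇒≡prefix (b ∷ w) (e , q) = cong₂ _∷_ e (≺⇒≡prefix w q)

prefix-+ : ∀ α m n → prefix α (m + n) ≡ prefix α m ++ prefix (shift m α) n
prefix-+ α zero n = refl
prefix-+ α (suc m) n = cong (α 0 ∷_) (prefix-+ (λ i → α (suc i)) m n)

≺-resp-≗ : ∀ w {α β} → α ≗ β → w ≺ α → w ≺ β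
≺-resp-≗ [] e p = tt
≺-resp-≗ (b ∷ w) e (p , q) = trans p (e 0) , ≺-resp-≗ w (λ i → e (suc i)) q

≺-++ : ∀ u v {α} → u ≺ α → v ≺ shift (length u) α → (u ++ v) ≺ α
≺-++ [] v p q = q
≺-++ (b ∷ u) v (p , q) r = p , ≺-++ u v q r

≺-++ˡ : ∀ u v {α} → (u ++ v) ≺ α → u ≺ α
≺-++ˡ [] v p = tt
≺-++ˡ (b ∷ u) v (p , q) = p , ≺-++ˡ u v q

≺-++ʳ : ∀ u v {α} → (u ++ v) ≺ α → v ≺ shift (length u) α
≺-++ʳ [] v p = p
≺-++ʳ (b ∷ u) v (p , q) = ≺-++ʳ u v q

≺-⊑ : ∀ {u w α} → u ⊑ w → w ≺ α → u ≺ α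
≺-⊑ {u} (r , refl) p = ≺-++ˡ u r p

≺⇒⊑prefix : ∀ w α n → w ≺ α → length w ≤ n → w ⊑ prefix α n
≺⇒⊑prefix w α n p l = prefix (shift (length w) α) (n ∸ length w) , (begin
  w ++ prefix (shift (length w) α) (n ∸ length w)
    ≡⟨ cong (_++ prefix (shift (length w) α) (n ∸ length w)) (≺⇒≡prefix w p) ⟩
  prefix α (length w) ++ prefix (shift (length w) α) (n ∸ length w)
    ≡⟨ prefix-+ α (length w) (n ∸ length w) ⟨
  prefix α (length w + (n ∸ length w))
    ≡⟨ cong (prefix α) (m+[n∸m]≡n l) ⟩
  prefix α n ∎)
  where open ≡-Reasoning

≺-at : ∀ u b v {α} → (u ++ b ∷ v) ≺ α → α (length u) ≡ b
≺-at u b v {α} p = sym (trans (proj₁ (≺-++ʳ u (b ∷ v) p)) (cong α (+-identityʳ (length u))))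

Zeros-≺ : ∀ w {α} → Zeros w → w ≺ α → ∀ i → i < length w → α i ≡ false
Zeros-≺ (b ∷ w) (z ∷ zs) (p , q) zero _ = trans (sym p) z
Zeros-≺ (b ∷ w) (z ∷ zs) (p , q) (suc i) (s≤s l) = Zeros-≺ w zs q i l

replicate-≺ : ∀ p x α → (∀ i → i < p → α i ≡ x) → replicate p x ≺ α
replicate-≺ zero x α f = tt
replicate-≺ (suc p) x α f =
  sym (f 0 (s≤s z≤n)) , replicate-≺ p x (λ i → α (suc i)) (λ i l → f (suc i) (s≤s l))

Zeros-prefix : ∀ α n → (∀ i → α i ≡ false) → Zeros (prefix α n)
Zeros-prefix α zero f = []
Zeros-prefix α (suc n) f = f 0 ∷ Zeros-prefix (λ i → α (suc i)) n (λ i → f (suc i))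

double : ℕ → ℕ
double zero = zero
double (suc n) = suc (suc (double n))

double-+ : ∀ a b → double (a + b) ≡ double a + double b
double-+ zero b = refl
double-+ (suc a) b = cong (λ x → suc (suc x)) (double-+ a b)

double-mono-< : ∀ {a b} → a < b → double a < double b
double-mono-< {zero} {suc b} _ = s≤s z≤n
double-mono-< {suc a} {suc b} (s≤s l) = s≤s (s≤s (double-mono-< l))

double-cancel-< : ∀ {a b} → double a < double b → a < b
double-cancel-< {zero} {suc b} _ = s≤s z≤n
double-cancel-< {suc a} {suc b} (s≤s (s≤s l)) = s≤s (double-cancel-< l)

suc-double-< : ∀ {i n} → i < n → suc (double i) < double n
suc-double-< {zero} {suc n} _ = s≤s (s≤s z≤n)
suc-double-< {suc i} {suc n} (s≤s l) = s≤s (s≤s (suc-double-< l))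

double-positive⁻¹ : ∀ {n} → 0 < double n → 0 < n
double-positive⁻¹ {suc n} _ = s≤s z≤n

double-positive : ∀ {n} → 0 < n → 0 < double n
double-positive {suc n} _ = s≤s z≤n

m<m+n⇒0<n : ∀ m {n} → m < m + n → 0 < n
m<m+n⇒0<n m {n} l = +-cancelˡ-< m 0 n (subst (_< m + n) (sym (+-identityʳ m)) l)

double-%2 : ∀ a → double a % 2 ≡ 0
double-%2 zero = refl
double-%2 (suc a) = double-%2 a

2*≡double : ∀ k → 2 * k ≡ double k
2*≡double zero = refl
2*≡double (suc k) = trans (cong suc (+-suc k (k + 0))) (cong (λ z → suc (suc z)) (2*≡double k))

evens∞ odds∞ : Cantor → Cantor
evens∞ α i = α (double i)
odds∞ α i = α (suc (double i))

evens∞-shift : ∀ α a → evens∞ (shift (double a) α) ≗ shift a (evens∞ α)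
evens∞-shift α a i = cong α (sym (double-+ a i))

odds∞-shift : ∀ α a → odds∞ (shift (double a) α) ≗ shift a (odds∞ α)
odds∞-shift α a i = cong α (trans (+-suc (double a) (double i)) (cong suc (sym (double-+ a i))))

evens-odds-≺ : ∀ w {α} → w ≺ α → (evens w ≺ evens∞ α) × (odds w ≺ odds∞ α)
evens-odds-≺ [] p = tt , tt
evens-odds-≺ (b ∷ w) (e , q) with evens-odds-≺ w q
... | (qe , qo) = (e , qo) , qe

evens-++ : ∀ u v → EvenLength u → evens (u ++ v) ≡ evens u ++ evens v
odds-++ : ∀ u v → EvenLength u → odds (u ++ v) ≡ odds u ++ odds v
evens-++ [] v p = refl
evens-++ (a ∷ b ∷ u) v p = cong (a ∷_) (evens-++ u v p)
odds-++ [] v p = refl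
odds-++ (a ∷ b ∷ u) v p = cong (b ∷_) (odds-++ u v p)

length-evens : ∀ w → EvenLength w → double (length (evens w)) ≡ length w
length-evens [] p = refl
length-evens (a ∷ b ∷ w) p = cong (λ x → suc (suc x)) (length-evens w p)

length-odds : ∀ w → EvenLength w → length (odds w) ≡ length (evens w)
length-odds [] p = refl
length-odds (a ∷ b ∷ w) p = cong suc (length-odds w p)

EvenLength-++ : ∀ u v → EvenLength u → EvenLength v → EvenLength (u ++ v)
EvenLength-++ u v p q = subst (λ z → z % 2 ≡ 0) len (double-%2 (length (evens u) + length (evens v)))
  where
  len : double (length (evens u) + length (evens v)) ≡ length (u ++ v)
  len = trans (double-+ (length (evens u)) (length (evens v)))
          (trans (cong₂ _+_ (length-evens u p) (length-evens v q)) (sym (length-++ u)))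

interleave : Word → Word → Word
interleave [] _ = []
interleave (e ∷ es) [] = []
interleave (e ∷ es) (o ∷ os) = e ∷ o ∷ interleave es os

interleave-≺ : ∀ E O {α} → length E ≡ length O → E ≺ evens∞ α → O ≺ odds∞ α → interleave E O ≺ α
interleave-≺ [] O l p q = tt
interleave-≺ (e ∷ E) (o ∷ O) l (p , p′) (q , q′) = p , q , interleave-≺ E O (cong pred l) p′ q′

evens-interleave : ∀ E O → length E ≡ length O → evens (interleave E O) ≡ E
evens-interleave [] [] l = refl
evens-interleave (e ∷ E) (o ∷ O) l = cong (e ∷_) (evens-interleave E O (cong pred l))

odds-interleave : ∀ E O → length E ≡ length O → odds (interleave E O) ≡ O
odds-interleave [] [] l = refl
odds-interleave (e ∷ E) (o ∷ O) l = cong (o ∷_) (odds-interleave E O (cong pred l))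

length-interleave : ∀ E O → length E ≡ length O → length (interleave E O) ≡ double (length E)
length-interleave [] [] l = refl
length-interleave (e ∷ E) (o ∷ O) l = cong (λ x → suc (suc x)) (length-interleave E O (cong pred l))

interleave∞ : Cantor → Cantor → Cantor
interleave∞ g h zero = g 0
interleave∞ g h (suc zero) = h 0
interleave∞ g h (suc (suc n)) = interleave∞ (λ i → g (suc i)) (λ i → h (suc i)) n

evens∞-interleave∞ : ∀ g h → evens∞ (interleave∞ g h) ≗ g
evens∞-interleave∞ g h zero = refl
evens∞-interleave∞ g h (suc i) = evens∞-interleave∞ (λ j → g (suc j)) (λ j → h (suc j)) i

odds∞-interleave∞ : ∀ g h → odds∞ (interleave∞ g h) ≗ h
odds∞-interleave∞ g h zero = refl
odds∞-interleave∞ g h (suc i) = odds∞-interleave∞ (λ j → g (suc j)) (λ j → h (suc j)) i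

Agree-sym : ∀ {n α β} → Agree n α β → Agree n β α
Agree-sym p i l = sym (p i l)

Agree-trans : ∀ {n α β γ} → Agree n α β → Agree n β γ → Agree n α γ
Agree-trans p q i l = trans (p i l) (q i l)

Agree-mono : ∀ {m n α β} → m ≤ n → Agree n α β → Agree m α β
Agree-mono l p i l′ = p i (≤-trans l′ l)

Agree-evens∞ : ∀ n {α β} → Agree (double n) α β → Agree n (evens∞ α) (evens∞ β)
Agree-evens∞ n p i l = p (double i) (double-mono-< l)

Agree-odds∞ : ∀ n {α β} → Agree (double n) α β → Agree n (odds∞ α) (odds∞ β)
Agree-odds∞ n p i l = p (suc (double i)) (suc-double-< l)

Agree-interleave∞ : ∀ n {g g′ h h′} → Agree n g g′ → Agree n h h′ →
  Agree n (interleave∞ g h) (interleave∞ g′ h′)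
Agree-interleave∞ n p q j l =
  at j _ _ _ _ (λ i l′ → p i (≤-trans (s≤s l′) l)) (λ i l′ → q i (≤-trans (s≤s l′) l))
  where
  at : ∀ j g g′ h h′ → (∀ i → i ≤ j → g i ≡ g′ i) → (∀ i → i ≤ j → h i ≡ h′ i) →
    interleave∞ g h j ≡ interleave∞ g′ h′ j
  at zero g g′ h h′ p q = p 0 z≤n
  at (suc zero) g g′ h h′ p q = q 0 z≤n
  at (suc (suc j)) g g′ h h′ p q =
    at j _ _ _ _ (λ i l → p (suc i) (s≤s (m≤n⇒m≤1+n l))) (λ i l → q (suc i) (s≤s (m≤n⇒m≤1+n l)))

Lipschitz : (Cantor → Cantor) → Set
Lipschitz h = ∀ α β n → Agree n α β → Agree n (h α) (h β)

evens∞-continuous : Continuous evens∞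
evens∞-continuous α n = double n , λ β → Agree-evens∞ n

interleave∞-continuous : ∀ {g h} → Continuous g → Lipschitz h → Continuous (λ x → interleave∞ (g x) (h x))
interleave∞-continuous cg lh α n =
  let (m , k) = cg α n in
  m + n , λ β a → Agree-interleave∞ n (k β (Agree-mono (m≤m+n m n) a)) (lh α β n (Agree-mono (m≤n+m n m) a))

Open-resp-⇔ : ∀ {U V : Pred} → (∀ x → U x ⇔ V x) → Open U → Open V
Open-resp-⇔ e oU x v = let (n , h) = oU x (from (e x) v) in
  n , λ β a → to (e β) (h β a)

Open-∩ : ∀ {U V : Pred} → Open U → Open V → Open (λ x → U x × V x)
Open-∩ oU oV x (u , v) =
  let (n , h) = oU x u ; (m , k) = oV x v in
  n + m , λ β a → h β (Agree-mono (m≤m+n n m) a) , k β (Agree-mono (m≤n+m m n) a)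

Open-∪ : ∀ {U V : Pred} → Open U → Open V → Open (λ x → U x ⊎ V x)
Open-∪ oU oV x (inj₁ u) = let (n , h) = oU x u in n , λ β a → inj₁ (h β a)
Open-∪ oU oV x (inj₂ v) = let (n , h) = oV x v in n , λ β a → inj₂ (h β a)

Open-∃ : ∀ {P : ℕ → Pred} → (∀ i → Open (P i)) → Open (λ x → ∃[ i ] P i x)
Open-∃ o x (i , p) = let (n , h) = o i x p in n , λ β a → i , h β a

Open-const : ∀ (P : Set) → Open (λ _ → P)
Open-const P x p = 0 , λ β a → p

Open-at : ∀ i b → Open (λ α → α i ≡ b)
Open-at i b x e = suc i , λ β a → trans (sym (a i ≤-refl)) e

Open-preimage : ∀ {P : Pred} {f : Cantor → Cantor} → Continuous f → Open P → Open (λ α → P (f α))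
Open-preimage {f = f} cf oP α p =
  let (n , h) = oP (f α) p ; (m , k) = cf α n in m , λ β a → h (f β) (k β a)

Open-odds∞ : ∀ {P : Pred} → Open P → Open (λ α → P (odds∞ α))
Open-odds∞ = Open-preimage (λ α n → double n , λ β → Agree-odds∞ n)

-- Building an ω-power block by block

record Block (M : Lang) (β : Cantor) (G : ℕ → Set) (a : ℕ) : Set where
  constructor block
  field
    words : List Word
    words∈M : All M words
    nonempty : 0 < length (concat words)
    matches : concat words ≺ shift a β
    good : G (a + length (concat words))

Extension : Lang → Cantor → (ℕ → Set) → Set
Extension M β G = ∀ a → G a → Block M β G a

module _ {M : Lang} {β : Cantor} {G : ℕ → Set} (g0 : G 0) (extend : Extension M β G) where
  private
    position : ℕ → ℕ
    goodAt : ∀ j → G (position j)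
    position zero = 0
    position (suc j) = position j + length (concat (Block.words (extend (position j) (goodAt j))))
    goodAt zero = g0
    goodAt (suc j) = Block.good (extend (position j) (goodAt j))

    next : ∀ j → Block M β G (position j)
    next j = extend (position j) (goodAt j)

    unconsNonempty : (ys : List Word) → 0 < length (concat ys) →
      Σ Word λ y → Σ (List Word) λ ys′ → y ∷ ys′ ≡ ys
    unconsNonempty (y ∷ ys) _ = y , ys , refl

    uncons : ∀ j → Σ Word λ y → Σ (List Word) λ ys′ → y ∷ ys′ ≡ Block.words (next j)
    uncons j = unconsNonempty _ (Block.nonempty (next j))

    hd : ℕ → Word
    hd j = proj₁ (uncons j)
    tl : ℕ → List Word
    tl j = proj₁ (proj₂ (uncons j))

    hd∷tl : ∀ j → hd j ∷ tl j ≡ Block.words (next j)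
    hd∷tl j = proj₂ (proj₂ (uncons j))

    hd∷tl∈M : ∀ j → All M (hd j ∷ tl j)
    hd∷tl∈M j = subst (All M) (sym (hd∷tl j)) (Block.words∈M (next j))

    upTo : ℕ → Word
    upTo = concatFirst (λ i → concat (hd i ∷ tl i))

    length-upTo : ∀ j → length (upTo j) ≡ position j
    length-upTo zero = refl
    length-upTo (suc j) =
      trans (length-++ (upTo j)) (cong₂ _+_ (length-upTo j) (cong (λ z → length (concat z)) (hd∷tl j)))

    upTo-≺ : ∀ j → upTo j ≺ β
    upTo-≺ zero = tt
    upTo-≺ (suc j) = ≺-++ (upTo j) _ (upTo-≺ j)
      (subst (λ z → concat (hd j ∷ tl j) ≺ shift z β) (sym (length-upTo j))
        (subst (λ z → concat z ≺ shift (position j) β) (sym (hd∷tl j)) (Block.matches (next j))))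

    position-≥ : ∀ j → j ≤ position j
    position-≥ zero = z≤n
    position-≥ (suc j) = ≤-trans (≤-reflexive (+-comm 1 j)) (+-mono-≤ (position-≥ j) (Block.nonempty (next j)))

    -- State (j , x , xs): the flattened sequence is at word x of block j, with xs still to come.
    State : Set
    State = ℕ × Word × List Word

    advance : State → State
    advance (j , x , []) = suc j , hd (suc j) , tl (suc j)
    advance (j , x , y ∷ ys) = j , y , ys

    state : ℕ → State
    state zero = 0 , hd 0 , tl 0
    state (suc n) = advance (state n)

    flat : ℕ → Word
    flat n = proj₁ (proj₂ (state n))

    Invariant : State → Word → Set
    Invariant (j , x , xs) w = (w ++ concat (x ∷ xs) ≡ upTo (suc j)) × All M (x ∷ xs)

    invariant-advance : ∀ s w → Invariant s w → Invariant (advance s) (w ++ proj₁ (proj₂ s))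
    invariant-advance (j , x , []) w (eq , a) =
      cong (_++ concat (hd (suc j) ∷ tl (suc j)))
        (trans (sym (++-identityʳ (w ++ x))) (trans (++-assoc w x []) eq)) , hd∷tl∈M (suc j)
    invariant-advance (j , x , y ∷ ys) w (eq , (px ∷ a)) = trans (++-assoc w x _) eq , a

    invariant : ∀ n → Invariant (state n) (concatFirst flat n)
    invariant zero = refl , hd∷tl∈M 0
    invariant (suc n) = invariant-advance (state n) (concatFirst flat n) (invariant n)

    walk : ∀ j n x xs → state n ≡ (j , x , xs) → state (n + suc (length xs)) ≡ (suc j , hd (suc j) , tl (suc j))
    walk j n x [] e = trans (cong state (+-comm n 1)) (cong advance e)
    walk j n x (y ∷ ys) e = trans (cong state (+-suc n (suc (length ys)))) (walk j (suc n) y ys (cong advance e))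

    reach : ∀ j → Σ ℕ λ n → state n ≡ (j , hd j , tl j)
    reach zero = 0 , refl
    reach (suc j) = let (n , e) = reach j in n + suc (length (tl j)) , walk j n (hd j) (tl j) e

    reach-long : ∀ j n → state n ≡ (j , hd j , tl j) → j ≤ length (concatFirst flat n)
    reach-long j n e with invariant n
    ... | (eq , _) rewrite e =
      ≤-trans (position-≥ j) (≤-reflexive (trans (sym (length-upTo j))
        (cong length (sym (++-cancelʳ (concat (hd j ∷ tl j)) (concatFirst flat n) (upTo j) eq)))))

  omegaPower-from-extension : OmegaPower M β
  omegaPower-from-extension =
    flat , flat∈M , flat-≺ , λ m → proj₁ (reach m) , reach-long m (proj₁ (reach m)) (proj₂ (reach m))
    where
    flat∈M : ∀ i → M (flat i)
    flat∈M n with state n | invariant n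
    ... | (j , x , xs) | (_ , (px ∷ _)) = px
    flat-≺ : ∀ n → concatFirst flat n ≺ β
    flat-≺ n with state n | invariant n
    ... | (j , x , xs) | (eq , _) = ≺-++ˡ (concatFirst flat n) _ (subst (_≺ β) (sym eq) (upTo-≺ (suc j)))

range : (ℕ → Word) → ℕ → ℕ → List Word
range ws c zero = []
range ws c (suc d) = ws c ∷ range ws (suc c) d

concatFirst-+ : ∀ ws c d → concatFirst ws (c + d) ≡ concatFirst ws c ++ concat (range ws c d)
concatFirst-+ ws c zero = trans (cong (concatFirst ws) (+-identityʳ c)) (sym (++-identityʳ _))
concatFirst-+ ws c (suc d) = trans (cong (concatFirst ws) (+-suc c d))
  (trans (concatFirst-+ ws (suc c) d) (++-assoc (concatFirst ws c) (ws c) _))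

All-range : ∀ {P : Word → Set} ws → (∀ i → P (ws i)) → ∀ c d → All P (range ws c d)
All-range ws f c zero = []
All-range ws f c (suc d) = f c ∷ All-range ws f (suc c) d

module Boundaries {β : Cantor} {ws : ℕ → Word} (ws-≺ : ∀ n → concatFirst ws n ≺ β)
                  (unbounded : ∀ m → ∃[ n ] (m ≤ length (concatFirst ws n))) where

  B : ℕ → ℕ
  B n = length (concatFirst ws n)

  B-range : ∀ c d → B (c + d) ≡ B c + length (concat (range ws c d))
  B-range c d = trans (cong length (concatFirst-+ ws c d)) (length-++ (concatFirst ws c))

  B-mono : ∀ {m n} → m ≤ n → B m ≤ B n
  B-mono {m} {n} l = subst (λ z → B m ≤ B z) (m+[n∸m]≡n l)
    (≤-trans (m≤m+n (B m) _) (≤-reflexive (sym (B-range m (n ∸ m)))))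

  B-cancel-< : ∀ {c c′} → B c < B c′ → c ≤ c′
  B-cancel-< {c} {c′} l with ≤-total c c′
  ... | inj₁ x = x
  ... | inj₂ y = ⊥-elim (<⇒≱ l (B-mono y))

  B-∸ : ∀ {c c′} → B c < B c′ → B c′ ≡ B c + length (concat (range ws c (c′ ∸ c)))
  B-∸ {c} {c′} l = trans (cong B (sym (m+[n∸m]≡n (B-cancel-< {c} {c′} l)))) (B-range c (c′ ∸ c))

  range-≺ : ∀ c d → concat (range ws c d) ≺ shift (B c) β
  range-≺ c d = ≺-++ʳ (concatFirst ws c) _ (subst (_≺ β) (concatFirst-+ ws c d) (ws-≺ (c + d)))

  beyond : ∀ t → Σ ℕ λ c → t < B c
  beyond t = unbounded (suc t)

-- From Lᵢ^∞ to L^∞ on the even half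

EvenStar : Lang → Lang
EvenStar L w = EvenLength w × Star L (evens w)

EvenStar-concat : ∀ L (xs : List Word) → All (EvenStar L) xs → EvenStar L (concat xs)
EvenStar-concat L [] [] = refl , [] , [] , refl
EvenStar-concat L (x ∷ xs) ((ex , zs , az , ez) ∷ a) with EvenStar-concat L xs a
... | (exs , ys , ay , ey) =
  EvenLength-++ x (concat xs) ex exs , zs ++ ys , ++⁺ az ay ,
  trans (sym (concat-++ zs ys)) (trans (cong₂ _++_ ez ey) (sym (evens-++ x (concat xs) ex)))

omegaPower-evens∞ : ∀ {M L α} → (∀ w → M w → EvenStar L w) → OmegaPower M α → OmegaPower L (evens∞ α)
omegaPower-evens∞ {L = L} {α} M⊆ (vs , vs∈M , vs-≺ , unb) =
  omegaPower-from-extension (0 , refl) extend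
  where
  open Boundaries vs-≺ unb
  extend : Extension L (evens∞ α) (λ a → Σ ℕ λ n → B n ≡ double a)
  extend a (n , Bn) with beyond (B n)
  ... | (c , Bn<Bc) with EvenStar-concat L (range vs n (c ∸ n)) (All-range vs (λ i → M⊆ _ (vs∈M i)) n (c ∸ n))
  ...   | (R-even , ys , ys∈L , ys≡) = block ys ys∈L nonempty matches (c , Bc)
    where
    R : Word
    R = concat (range vs n (c ∸ n))
    Bc≡ : B c ≡ B n + length R
    Bc≡ = B-∸ {n} {c} Bn<Bc
    len : double (length (concat ys)) ≡ length R
    len = trans (cong (λ z → double (length z)) ys≡) (length-evens R R-even)
    nonempty : 0 < length (concat ys)
    nonempty = double-positive⁻¹ (subst (0 <_) (sym len) (m<m+n⇒0<n (B n) (subst (B n <_) Bc≡ Bn<Bc)))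
    matches : concat ys ≺ shift a (evens∞ α)
    matches = subst (_≺ shift a (evens∞ α)) (sym ys≡)
      (≺-resp-≗ (evens R) (λ i → trans (cong (λ z → α (z + double i)) Bn) (evens∞-shift α a i))
        (proj₁ (evens-odds-≺ R (range-≺ n (c ∸ n)))))
    Bc : B c ≡ double (a + length (concat ys))
    Bc = trans Bc≡ (trans (cong₂ _+_ Bn (sym len)) (sym (double-+ a _)))

true≢false : true ≢ false
true≢false ()

AllZero : Pred
AllZero s = ∀ i → s i ≡ false

SomeOne : Pred
SomeOne s = ∃[ i ] (s i ≡ true)

TwoOnes : Pred
TwoOnes s = Σ ℕ λ i → Σ ℕ λ j → i < j × s i ≡ true × s j ≡ true

Q₀ Q₂ : Pred
Q₀ s = (s 0 ≡ false) ⊎ (∃[ i ] (s (suc i) ≡ true))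
Q₂ s = AllZero s ⊎ TwoOnes s

¬SomeOne⇒AllZero : ∀ {s} → ¬ SomeOne s → AllZero s
¬SomeOne⇒AllZero n i = ¬-not (λ e → n (i , e))

AllZero⇒¬SomeOne : ∀ {s} → AllZero s → ¬ SomeOne s
AllZero⇒¬SomeOne z (i , e) = true≢false (trans (sym e) (z i))

Q₀-open : Open Q₀
Q₀-open = Open-∪ (Open-at 0 false) (Open-∃ (λ i → Open-at (suc i) true))

SomeOne-open : Open SomeOne
SomeOne-open = Open-∃ (λ i → Open-at i true)

TwoOnes-open : Open TwoOnes
TwoOnes-open = Open-∃ λ i → Open-∃ λ j → Open-∩ (Open-const (i < j)) (Open-∩ (Open-at i true) (Open-at j true))

AllZero⇔¬SomeOne : ∀ s → AllZero s ⇔ (¬ SomeOne s)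
AllZero⇔¬SomeOne s = mk⇔ AllZero⇒¬SomeOne ¬SomeOne⇒AllZero

module OddHalf {M L : Lang} (M⊆ : ∀ w → M w → EvenStar L w) {α : Cantor} {vs : ℕ → Word}
               (vs∈M : ∀ i → M (vs i)) (vs-≺ : ∀ n → concatFirst vs n ≺ α)
               (unb : ∀ m → ∃[ n ] (m ≤ length (concatFirst vs n))) where

  EvenLength-concatFirst : ∀ n → EvenLength (concatFirst vs n)
  EvenLength-concatFirst zero = refl
  EvenLength-concatFirst (suc n) =
    EvenLength-++ (concatFirst vs n) (vs n) (EvenLength-concatFirst n) (proj₁ (M⊆ _ (vs∈M n)))

  odds-concatFirst : ∀ n → odds (concatFirst vs (suc n)) ≡ odds (concatFirst vs n) ++ odds (vs n)
  odds-concatFirst n = odds-++ (concatFirst vs n) (vs n) (EvenLength-concatFirst n)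

  odds-concatFirst-≺ : ∀ n → odds (concatFirst vs n) ≺ odds∞ α
  odds-concatFirst-≺ n = proj₂ (evens-odds-≺ _ (vs-≺ n))

  odds-block-≺ : ∀ n → odds (vs n) ≺ shift (length (odds (concatFirst vs n))) (odds∞ α)
  odds-block-≺ n = ≺-++ʳ (odds (concatFirst vs n)) (odds (vs n))
    (subst (_≺ odds∞ α) (odds-concatFirst n) (odds-concatFirst-≺ (suc n)))

  long-odds : ∀ j → Σ ℕ λ n → j < length (odds (concatFirst vs n))
  long-odds j = let (n , l) = unb (double (suc j)) in
    n , double-cancel-< (≤-trans (double-mono-< (n<1+n j)) (≤-trans l (≤-reflexive (sym (len n)))))
    where
    len : ∀ n → double (length (odds (concatFirst vs n))) ≡ length (concatFirst vs n)
    len n = trans (cong double (length-odds (concatFirst vs n) (EvenLength-concatFirst n)))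
                  (length-evens (concatFirst vs n) (EvenLength-concatFirst n))

  AllZero-odds∞ : (∀ n → Zeros (odds (concatFirst vs n))) → AllZero (odds∞ α)
  AllZero-odds∞ z j = let (n , l) = long-odds j in
    Zeros-≺ (odds (concatFirst vs n)) (z n) (odds-concatFirst-≺ n) j l

Lᵢ⊆EvenStar : ∀ {L} {P : Word → Set} w → EvenLength w × Star L (evens w) × P w → EvenStar L w
Lᵢ⊆EvenStar w (e , s , _) = e , s

Q₀-odds∞ : ∀ {L α} → OmegaPower (L₀ L) α → Q₀ (odds∞ α)
Q₀-odds∞ {L} {α} (vs , vs∈M , vs-≺ , _) with proj₂ (evens-odds-≺ (vs 0) (vs-≺ 1)) | proj₂ (proj₂ (vs∈M 0))
... | odds-≺ | inj₁ 0⊑ = inj₁ (sym (proj₁ (≺-⊑ 0⊑ odds-≺)))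
... | odds-≺ | inj₂ (q , 10^q1⊑) =
  inj₂ (length (replicate q false) , ≺-at (true ∷ replicate q false) true [] {odds∞ α} (≺-⊑ 10^q1⊑ odds-≺))

AllZero-odds∞-L₁ : ∀ {L α} → OmegaPower (L₁ L) α → AllZero (odds∞ α)
AllZero-odds∞-L₁ {L} (vs , vs∈M , vs-≺ , unb) = AllZero-odds∞ zeros
  where
  open OddHalf {L₁ L} {L} Lᵢ⊆EvenStar vs∈M vs-≺ unb
  zeros : ∀ n → Zeros (odds (concatFirst vs n))
  zeros zero = []
  zeros (suc n) = subst Zeros (sym (odds-concatFirst n)) (++⁺ (zeros n) (proj₂ (proj₂ (vs∈M n))))

TwoOnes-shift : ∀ h {s} → TwoOnes (shift h s) → TwoOnes s
TwoOnes-shift h (i , j , i<j , si , sj) = h + i , h + j , +-monoʳ-< h i<j , si , sj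

0ᵖ10ᵠ1-TwoOnes : ∀ p q {s} → (replicate p false ++ one0q1 q) ≺ s → TwoOnes s
0ᵖ10ᵠ1-TwoOnes p q {s} ≺s =
  length (replicate p false) , length u , len< ,
  ≺-at (replicate p false) true (replicate q false ++ true ∷ []) ≺s ,
  ≺-at u true [] (subst (_≺ s) (sym (++-assoc (replicate p false) (true ∷ replicate q false) (true ∷ []))) ≺s)
  where
  u : Word
  u = replicate p false ++ true ∷ replicate q false
  len< : length (replicate p false) < length u
  len< = subst (length (replicate p false) <_) (sym (length-++ (replicate p false))) (m<m+n _ (s≤s z≤n))

Q₂-odds∞ : Classical → ∀ {L α} → OmegaPower (L₂ L) α → Q₂ (odds∞ α)
Q₂-odds∞ cl {L} {α} (vs , vs∈M , vs-≺ , unb) with cl (TwoOnes (odds∞ α))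
... | inj₁ two = inj₂ two
... | inj₂ ¬two = inj₁ (AllZero-odds∞ zeros)
  where
  open OddHalf {L₂ L} {L} Lᵢ⊆EvenStar vs∈M vs-≺ unb
  zeros : ∀ n → Zeros (odds (concatFirst vs n))
  zeros zero = []
  zeros (suc n) with proj₂ (proj₂ (vs∈M n))
  ... | inj₁ z = subst Zeros (sym (odds-concatFirst n)) (++⁺ (zeros n) z)
  ... | inj₂ (p , q , ⊑odds) =
    ⊥-elim (¬two (TwoOnes-shift _ (0ᵖ10ᵠ1-TwoOnes p q (≺-⊑ ⊑odds (odds-block-≺ n)))))

-- From L^∞ on the even half back to Lᵢ^∞

first-true : (t : ℕ → Bool) (n : ℕ) → t n ≡ true →
  Σ ℕ λ m → m ≤ n × t m ≡ true × (∀ k → k < m → t k ≡ false)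
first-true t zero e = 0 , z≤n , e , λ k ()
first-true t (suc n) e with t 0 in t0
... | true = 0 , z≤n , t0 , λ k ()
... | false with first-true (λ i → t (suc i)) n e
... | (m , l , tm , before) = suc m , s≤s l , tm , before′
  where
  before′ : ∀ k → k < suc m → t k ≡ false
  before′ zero _ = t0
  before′ (suc k) (s≤s l′) = before k l′

10ᵠ1-≺ : ∀ t → t 0 ≡ true → ∃[ i ] (t (suc i) ≡ true) → ∃[ q ] (one0q1 q ≺ t)
10ᵠ1-≺ t t0 (i , ti) with first-true (λ j → t (suc j)) i ti
... | (q , _ , tq , before) =
  q , sym t0 , ≺-++ (replicate q false) (true ∷ []) (replicate-≺ q false _ before)
    (sym (trans (cong (λ z → t (suc z)) (trans (+-identityʳ _) (length-replicate q))) tq) , tt)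

TwoOnes⇒0ᵖ10ᵠ1 : ∀ {t} → TwoOnes t → Σ ℕ λ p → Σ ℕ λ q → (replicate p false ++ one0q1 q) ≺ t
TwoOnes⇒0ᵖ10ᵠ1 {t} (i , j , i<j , ti , tj) with first-true t i ti
... | (p , p≤i , tp , before) =
  p , proj₁ rest , ≺-++ (replicate p false) (one0q1 (proj₁ rest)) (replicate-≺ p false t before)
    (subst (λ z → one0q1 (proj₁ rest) ≺ shift z t) (sym (length-replicate p)) (proj₂ rest))
  where
  later : Σ ℕ λ j′ → p < j′ × t j′ ≡ true
  later with m≤n⇒m<n∨m≡n p≤i
  ... | inj₁ p<i = i , p<i , ti
  ... | inj₂ refl = j , i<j , tj
  rest : ∃[ q ] (one0q1 q ≺ shift p t)
  rest with later
  ... | (j′ , p<j′ , tj′) = 10ᵠ1-≺ (shift p t) (trans (cong t (+-identityʳ p)) tp)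
    (j′ ∸ suc p , subst (λ m → t m ≡ true) (sym (trans (+-suc p _) (m+[n∸m]≡n p<j′))) tj′)

L₀-oddPart L₂-oddPart : Word → Set
L₀-oddPart v = ((false ∷ []) ⊑ v) ⊎ ∃[ q ] (one0q1 q ⊑ v)
L₂-oddPart v = Zeros v ⊎ ∃[ p ] ∃[ q ] ((replicate p false ++ one0q1 q) ⊑ v)

module Backward {L : Lang} {α : Cantor} {ws : ℕ → Word} (ws∈L : ∀ i → L (ws i))
                (ws-≺ : ∀ n → concatFirst ws n ≺ evens∞ α)
                (unb : ∀ m → ∃[ n ] (m ≤ length (concatFirst ws n))) where
  open Boundaries ws-≺ unb

  s : Cantor
  s = odds∞ α

  -- The block of α whose even half is w_c ⋯ w_{c+d-1}.
  E O W : ℕ → ℕ → Word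
  E c d = concat (range ws c d)
  O c d = prefix (shift (B c) s) (length (E c d))
  W c d = interleave (E c d) (O c d)

  length-E≡O : ∀ c d → length (E c d) ≡ length (O c d)
  length-E≡O c d = sym (length-prefix _ _)

  length-W : ∀ c d → length (W c d) ≡ double (length (E c d))
  length-W c d = length-interleave (E c d) (O c d) (length-E≡O c d)

  W-EvenLength : ∀ c d → EvenLength (W c d)
  W-EvenLength c d = subst (λ z → z % 2 ≡ 0) (sym (length-W c d)) (double-%2 (length (E c d)))

  W-Star : ∀ c d → Star L (evens (W c d))
  W-Star c d = range ws c d , All-range ws ws∈L c d , sym (evens-interleave (E c d) (O c d) (length-E≡O c d))

  odds-W : ∀ c d → odds (W c d) ≡ O c d
  odds-W c d = odds-interleave (E c d) (O c d) (length-E≡O c d)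

  W-≺ : ∀ c d → W c d ≺ shift (double (B c)) α
  W-≺ c d = interleave-≺ (E c d) (O c d) (length-E≡O c d)
    (≺-resp-≗ (E c d) (λ i → sym (evens∞-shift α (B c) i)) (range-≺ c d))
    (≺-resp-≗ (O c d) (λ i → sym (odds∞-shift α (B c) i)) (prefix-≺ _ _))

  ⊑odds-W : ∀ c c′ w → B c < B c′ → w ≺ shift (B c) s → B c + length w ≤ B c′ → w ⊑ odds (W c (c′ ∸ c))
  ⊑odds-W c c′ w lt p l = subst (w ⊑_) (sym (odds-W c (c′ ∸ c)))
    (≺⇒⊑prefix w (shift (B c) s) _ p (+-cancelˡ-≤ (B c) _ _ (≤-trans l (≤-reflexive (B-∸ {c} {c′} lt)))))

  Zeros-odds-W : ∀ c c′ → (∀ i → s (B c + i) ≡ false) → Zeros (odds (W c (c′ ∸ c)))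
  Zeros-odds-W c c′ f = subst Zeros (sym (odds-W c (c′ ∸ c))) (Zeros-prefix (shift (B c) s) _ f)

  Step : (Word → Set) → (ℕ → Set) → Set
  Step P good = ∀ c → good (B c) → Σ ℕ λ c′ → B c < B c′ × good (B c′) × P (odds (W c (c′ ∸ c)))

  omegaPower-from-steps : (P : Word → Set) (good : ℕ → Set) → good 0 → Step P good →
    OmegaPower (λ w → EvenLength w × Star L (evens w) × P (odds w)) α
  omegaPower-from-steps P good g0 step =
    omegaPower-from-extension {G = λ p → Σ ℕ λ c → p ≡ double (B c) × good (B c)} (0 , refl , g0) extend
    where
    extend : Extension (λ w → EvenLength w × Star L (evens w) × P (odds w)) α
                       (λ p → Σ ℕ λ c → p ≡ double (B c) × good (B c))
    extend _ (c , refl , gc) with step c gc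
    ... | (c′ , lt , gc′ , p) =
      block (W c d ∷ []) ((W-EvenLength c d , W-Star c d , p) ∷ []) nonempty matches (c′ , position , gc′)
      where
      d : ℕ
      d = c′ ∸ c
      Bc′≡ : B c′ ≡ B c + length (E c d)
      Bc′≡ = B-∸ {c} {c′} lt
      len : length (W c d ++ []) ≡ double (length (E c d))
      len = trans (cong length (++-identityʳ (W c d))) (length-W c d)
      nonempty : 0 < length (W c d ++ [])
      nonempty = subst (0 <_) (sym len) (double-positive (m<m+n⇒0<n (B c) (subst (B c <_) Bc′≡ lt)))
      matches : (W c d ++ []) ≺ shift (double (B c)) α
      matches = subst (_≺ shift (double (B c)) α) (sym (++-identityʳ (W c d))) (W-≺ c d)
      position : double (B c) + length (W c d ++ []) ≡ double (B c′)
      position = trans (cong (double (B c) +_) len) (trans (sym (double-+ (B c) _)) (cong double (sym Bc′≡)))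

  step₁ : AllZero s → Step Zeros (λ _ → ⊤)
  step₁ z c _ = let (c′ , lt) = beyond (B c) in c′ , lt , tt , Zeros-odds-W c c′ (λ i → z (B c + i))

  Q₀-beyond : Classical → ∀ t → Σ ℕ λ c′ → t < B c′ × Q₀ (shift (B c′) s)
  Q₀-beyond cl t with beyond t
  ... | (c₁ , t<) with cl (∃[ i ] (s (B c₁ + suc i) ≡ true))
  ...   | inj₁ one = c₁ , t< , inj₂ one
  ...   | inj₂ none with beyond (B c₁)
  ...     | (c₂ , c₁<c₂) =
    c₂ , <-trans t< c₁<c₂ , inj₁ (subst (λ m → s m ≡ false) Bc₂ (¬-not (λ e → none (k , e))))
    where
    k : ℕ
    k = B c₂ ∸ suc (B c₁)
    Bc₂ : B c₁ + suc k ≡ B c₂ + 0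
    Bc₂ = trans (+-suc (B c₁) k) (trans (m+[n∸m]≡n c₁<c₂) (sym (+-identityʳ _)))

  step₀ : Classical → Step L₀-oddPart (λ a → Q₀ (shift a s))
  step₀ cl c q with s (B c + 0) in s₀
  ... | false = let (c′ , lt , q′) = Q₀-beyond cl (B c) in
    c′ , lt , q′ , inj₁ (⊑odds-W c c′ (false ∷ []) lt (sym s₀ , tt) (subst (_≤ B c′) (+-comm 1 (B c)) lt))
  ... | true with q
  ...   | inj₁ ()
  ...   | inj₂ one with 10ᵠ1-≺ (shift (B c) s) s₀ one
  ...     | (q , ≺s) = let (c′ , lt , q′) = Q₀-beyond cl (B c + length (one0q1 q)) in
    c′ , ≤-<-trans (m≤m+n (B c) _) lt , q′ ,
    inj₂ (q , ⊑odds-W c c′ (one0q1 q) (≤-<-trans (m≤m+n (B c) _) lt) ≺s (<⇒≤ lt))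

  Q₂-beyond : Classical → ∀ t → Σ ℕ λ c′ → t < B c′ × Q₂ (shift (B c′) s)
  Q₂-beyond cl t with beyond t
  ... | (c₁ , t<) with cl (TwoOnes (shift (B c₁) s))
  ...   | inj₁ two = c₁ , t< , inj₂ two
  ...   | inj₂ ¬two with cl (SomeOne (shift (B c₁) s))
  ...     | inj₂ none = c₁ , t< , inj₁ (¬SomeOne⇒AllZero none)
  ...     | inj₁ (i , sᵢ) with beyond (B c₁ + i)
  ...       | (c₂ , <c₂) = c₂ , <-≤-trans t< (≤-trans (m≤m+n _ i) (<⇒≤ <c₂)) , inj₁ zeros
    where
    Bc₁≤Bc₂ : B c₁ ≤ B c₂
    Bc₁≤Bc₂ = ≤-trans (m≤m+n (B c₁) i) (<⇒≤ <c₂)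
    i< : i < B c₂ ∸ B c₁
    i< = +-cancelˡ-< (B c₁) i (B c₂ ∸ B c₁) (subst (B c₁ + i <_) (sym (m+[n∸m]≡n Bc₁≤Bc₂)) <c₂)
    zeros : AllZero (shift (B c₂) s)
    zeros k = ¬-not (λ sₖ → ¬two (i , (B c₂ ∸ B c₁) + k , ≤-trans i< (m≤m+n _ k) , sᵢ ,
      subst (λ m → s m ≡ true) (sym (trans (sym (+-assoc (B c₁) (B c₂ ∸ B c₁) k))
                                          (cong (_+ k) (m+[n∸m]≡n Bc₁≤Bc₂)))) sₖ))

  step₂ : Classical → Step L₂-oddPart (λ a → Q₂ (shift a s))
  step₂ cl c (inj₁ z) = let (c′ , lt , q′) = Q₂-beyond cl (B c) in c′ , lt , q′ , inj₁ (Zeros-odds-W c c′ z)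
  step₂ cl c (inj₂ two) with TwoOnes⇒0ᵖ10ᵠ1 two
  ... | (p , q , ≺s) = let (c′ , lt , q′) = Q₂-beyond cl (B c + length (replicate p false ++ one0q1 q)) in
    c′ , ≤-<-trans (m≤m+n (B c) _) lt , q′ ,
    inj₂ (p , q , ⊑odds-W c c′ _ (≤-<-trans (m≤m+n (B c) _) lt) ≺s (<⇒≤ lt))

-- Lᵢ^∞ is L^∞ on the even half together with Qᵢ on the odd half

Splits : Lang → Lang → Pred → Set
Splits M L Q = ∀ α → OmegaPower M α ⇔ (OmegaPower L (evens∞ α) × Q (odds∞ α))

L₀-splits : Classical → ∀ L → Splits (L₀ L) L Q₀
L₀-splits cl L α = mk⇔ (λ w → omegaPower-evens∞ {L₀ L} Lᵢ⊆EvenStar w , Q₀-odds∞ w) back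
  where
  back : OmegaPower L (evens∞ α) × Q₀ (odds∞ α) → OmegaPower (L₀ L) α
  back ((ws , ws∈L , ws-≺ , unb) , q) = omegaPower-from-steps L₀-oddPart (λ a → Q₀ (shift a s)) q (step₀ cl)
    where open Backward {L} {α} ws∈L ws-≺ unb

L₁-splits : ∀ L → Splits (L₁ L) L AllZero
L₁-splits L α = mk⇔ (λ w → omegaPower-evens∞ {L₁ L} Lᵢ⊆EvenStar w , AllZero-odds∞-L₁ w) back
  where
  back : OmegaPower L (evens∞ α) × AllZero (odds∞ α) → OmegaPower (L₁ L) α
  back ((ws , ws∈L , ws-≺ , unb) , z) = omegaPower-from-steps Zeros (λ _ → ⊤) tt (step₁ z)
    where open Backward {L} {α} ws∈L ws-≺ unb

L₂-splits : Classical → ∀ L → Splits (L₂ L) L Q₂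
L₂-splits cl L α = mk⇔ (λ w → omegaPower-evens∞ {L₂ L} Lᵢ⊆EvenStar w , Q₂-odds∞ cl w) back
  where
  back : OmegaPower L (evens∞ α) × Q₂ (odds∞ α) → OmegaPower (L₂ L) α
  back ((ws , ws∈L , ws-≺ , unb) , q) = omegaPower-from-steps L₂-oddPart (λ a → Q₂ (shift a s)) q (step₂ cl)
    where open Backward {L} {α} ws∈L ws-≺ unb

Respects≗ : Pred → Set
Respects≗ Q = ∀ {s t} → s ≗ t → Q s → Q t

OmegaPower-resp-≗ : ∀ M → Respects≗ (OmegaPower M)
OmegaPower-resp-≗ M e (ws , ws∈M , ws-≺ , unb) = ws , ws∈M , (λ n → ≺-resp-≗ _ e (ws-≺ n)) , unb

Q₀-resp-≗ : Respects≗ Q₀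
Q₀-resp-≗ e (inj₁ s₀) = inj₁ (trans (sym (e 0)) s₀)
Q₀-resp-≗ e (inj₂ (i , sᵢ)) = inj₂ (i , trans (sym (e (suc i))) sᵢ)

AllZero-resp-≗ : Respects≗ AllZero
AllZero-resp-≗ e z i = trans (sym (e i)) (z i)

Q₂-resp-≗ : Respects≗ Q₂
Q₂-resp-≗ e (inj₁ z) = inj₁ (AllZero-resp-≗ e z)
Q₂-resp-≗ e (inj₂ (i , j , l , sᵢ , sⱼ)) = inj₂ (i , j , l , trans (sym (e i)) sᵢ , trans (sym (e j)) sⱼ)

Splits-interleave∞ : ∀ M L {Q} → Splits M L Q → Respects≗ Q →
  ∀ a b → OmegaPower M (interleave∞ a b) ⇔ (OmegaPower L a × Q b)
Splits-interleave∞ M L split Q-resp a b = mk⇔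
  (λ w → let (x , y) = to (split (interleave∞ a b)) w in
    OmegaPower-resp-≗ L (evens∞-interleave∞ a b) x , Q-resp (odds∞-interleave∞ a b) y)
  (λ (x , y) → from (split (interleave∞ a b))
    (OmegaPower-resp-≗ L (λ i → sym (evens∞-interleave∞ a b i)) x ,
     Q-resp (λ i → sym (odds∞-interleave∞ a b i)) y))

Reduces : Pred → Pred → Set
Reduces B A = ∃[ f ] (Continuous f × (∀ x → B x ⇔ A (f x)))

Reduces-interleave∞ : ∀ M L {Q A P B : Pred} {h} → Splits M L Q → Respects≗ Q →
  Reduces A (OmegaPower L) → Lipschitz h → (∀ x → P x ⇔ Q (h x)) → (∀ x → B x ⇔ (A x × P x)) →
  Reduces B (OmegaPower M)
Reduces-interleave∞ M L {h = h} split Q-resp (g , g-cont , g-red) h-lip h-red B⇔ =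
  (λ x → interleave∞ (g x) (h x)) , interleave∞-continuous g-cont h-lip , λ x → mk⇔
    (λ b → let (a , p) = to (B⇔ x) b in
      from (Splits-interleave∞ M L split Q-resp (g x) (h x))
        (to (g-red x) a , to (h-red x) p))
    (λ w → let (a , q) = to (Splits-interleave∞ M L split Q-resp (g x) (h x)) w in
      from (B⇔ x) (from (g-red x) a , from (h-red x) q))

%2≡0⊎1 : ∀ n → n % 2 ≡ 0 ⊎ n % 2 ≡ 1
%2≡0⊎1 zero = inj₁ refl
%2≡0⊎1 (suc zero) = inj₂ refl
%2≡0⊎1 (suc (suc n)) = %2≡0⊎1 n

suc-%2≢ : ∀ n → suc n % 2 ≢ n % 2
suc-%2≢ zero ()
suc-%2≢ (suc zero) ()
suc-%2≢ (suc (suc n)) = suc-%2≢ n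

%2-pigeonhole : ∀ a b c → a % 2 ≢ c % 2 → b % 2 ≢ c % 2 → a % 2 ≡ b % 2
%2-pigeonhole a b c a≢c b≢c with %2≡0⊎1 a | %2≡0⊎1 b | %2≡0⊎1 c
... | inj₁ x | inj₁ y | _ = trans x (sym y)
... | inj₂ x | inj₂ y | _ = trans x (sym y)
... | inj₁ x | inj₂ y | inj₁ z = ⊥-elim (a≢c (trans x (sym z)))
... | inj₁ x | inj₂ y | inj₂ z = ⊥-elim (b≢c (trans y (sym z)))
... | inj₂ x | inj₁ y | inj₁ z = ⊥-elim (b≢c (trans y (sym z)))
... | inj₂ x | inj₁ y | inj₂ z = ⊥-elim (a≢c (trans x (sym z)))

≢suc-%2⇔≡ : ∀ a b → (a % 2 ≢ suc b % 2) ⇔ (a % 2 ≡ b % 2)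
≢suc-%2⇔≡ a b = mk⇔
  (λ a≢ → %2-pigeonhole a b (suc b) a≢ (λ e → suc-%2≢ b (sym e)))
  (λ a≡ e → suc-%2≢ b (sym (trans (sym a≡) e)))

suc-%2⇔ : ∀ a b → (suc a % 2 ≡ suc b % 2) ⇔ (a % 2 ≡ b % 2)
suc-%2⇔ a b = mk⇔
  (λ e → %2-pigeonhole a b (suc b) (λ e′ → suc-%2≢ a (trans e (sym e′))) (λ e′ → suc-%2≢ b (sym e′)))
  (λ e → %2-pigeonhole (suc a) (suc b) b (λ e′ → suc-%2≢ a (trans e′ (sym e))) (suc-%2≢ b))

≢-%2⇔≡suc : ∀ a b → (a % 2 ≢ b % 2) ⇔ (a % 2 ≡ suc b % 2)
≢-%2⇔≡suc a b = mk⇔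
  (λ a≢ → %2-pigeonhole a (suc b) b a≢ (suc-%2≢ b))
  (λ a≡ e → suc-%2≢ b (trans (sym a≡) e))

suc-%2-of-even : ∀ n → n % 2 ≡ 0 → suc n % 2 ≡ 1
suc-%2-of-even n e with %2≡0⊎1 (suc n)
... | inj₁ x = ⊥-elim (suc-%2≢ n (trans x (sym e)))
... | inj₂ x = x

0≢1 : 0 ≢ 1
0≢1 ()

-- Ranks: D_ζ(Σ⁰₁) sets as parity conditions on functions into {0, …, ζ} with open sublevel sets

IsRank : ℕ → (Cantor → ℕ) → Set
IsRank ζ r = (∀ x → r x ≤ ζ) × (∀ η → η < ζ → Open (λ x → r x ≤ η))

RankedD RankedDˇ : ℕ → Pred → Set
RankedD ζ A = Σ (Cantor → ℕ) λ r → IsRank ζ r × (∀ x → A x ⇔ (r x % 2 ≢ ζ % 2))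
RankedDˇ ζ A = Σ (Cantor → ℕ) λ r → IsRank ζ r × (∀ x → A x ⇔ (r x % 2 ≡ ζ % 2))

IsRank-open-≤ : ∀ {ζ r} → IsRank ζ r → ∀ η → Open (λ x → r x ≤ η)
IsRank-open-≤ {ζ} (bounded , open≤) η with η <? ζ
... | yes η<ζ = open≤ η η<ζ
... | no η≮ζ = Open-resp-⇔ (λ x → mk⇔ (λ _ → ≤-trans (bounded x) (≮⇒≥ η≮ζ)) (λ _ → tt)) (Open-const ⊤)

IsRank-open-< : ∀ {ζ r} → IsRank ζ r → ∀ η → Open (λ x → r x < η)
IsRank-open-< rk zero = Open-resp-⇔ (λ x → mk⇔ (λ ()) (λ ())) (Open-const ⊥)
IsRank-open-< rk (suc η) = Open-resp-⇔ (λ x → mk⇔ s≤s ≤-pred) (IsRank-open-≤ rk η)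

IsRank-⊓ : ∀ {ζ ζ′ r} → ζ ≤ ζ′ → IsRank ζ′ r → IsRank ζ (λ x → r x ⊓ ζ)
IsRank-⊓ {ζ} {r = r} ζ≤ζ′ (bounded , open≤) =
  (λ x → m⊓n≤n (r x) ζ) ,
  λ η η<ζ → Open-resp-⇔ (λ x → mk⇔ (≤-trans (m⊓n≤m (r x) ζ)) (⊓-≤ η η<ζ x)) (open≤ η (<-≤-trans η<ζ ζ≤ζ′))
  where
  ⊓-≤ : ∀ η → η < ζ → ∀ x → r x ⊓ ζ ≤ η → r x ≤ η
  ⊓-≤ η η<ζ x p with r x ≤? ζ
  ... | yes q = subst (_≤ η) (m≤n⇒m⊓n≡m q) p
  ... | no q = ⊥-elim (<⇒≱ η<ζ (subst (_≤ η) (m≥n⇒m⊓n≡n (<⇒≤ (≰⇒> q))) p))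

IsRank-pred : ∀ {ζ r} → IsRank (suc ζ) r → IsRank ζ (λ x → pred (r x))
IsRank-pred {r = r} (bounded , open≤) =
  (λ x → pred-mono-≤ (bounded x)) ,
  λ η l → Open-resp-⇔ (λ x → mk⇔ (pred-≤ η x) (pred-≤⁻¹ η x)) (open≤ (suc η) (s≤s l))
  where
  pred-≤ : ∀ η x → r x ≤ suc η → pred (r x) ≤ η
  pred-≤ η x p with r x
  ... | zero = z≤n
  ... | suc m = ≤-pred p
  pred-≤⁻¹ : ∀ η x → pred (r x) ≤ η → r x ≤ suc η
  pred-≤⁻¹ η x p with r x
  ... | zero = z≤n
  ... | suc m = s≤s p

RankedD⇒D : ∀ {ζ A} → RankedD ζ A → D ζ A
RankedD⇒D {ζ} {A} (r , (bounded , open≤) , A⇔) =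
  (λ η x → r x ≤ η) , open≤ , (λ θ η θ≤η _ x p → ≤-trans p θ≤η) , λ x → mk⇔ (into x) (outof x)
  where
  into : ∀ x → A x → Dset ζ (λ η x → r x ≤ η) x
  into x a = r x , r<ζ , r≢ , ≤-refl , λ θ l p → <⇒≱ l p
    where
    r≢ : r x % 2 ≢ ζ % 2
    r≢ = to (A⇔ x) a
    r<ζ : r x < ζ
    r<ζ = ≤∧≢⇒< (bounded x) (λ e → r≢ (cong (_% 2) e))
  outof : ∀ x → Dset ζ (λ η x → r x ≤ η) x → A x
  outof x (η , _ , η≢ , p , before) = from (A⇔ x) (subst (λ z → z % 2 ≢ ζ % 2) (sym r≡η) η≢)
    where
    r≡η : r x ≡ η
    r≡η with m≤n⇒m<n∨m≡n p
    ... | inj₁ l = ⊥-elim (before (r x) l ≤-refl)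
    ... | inj₂ q = q

RankedDˇ⇒Dˇ : ∀ {ζ A} → RankedDˇ ζ A → Dˇ ζ A
RankedDˇ⇒Dˇ {ζ} (r , rk , A⇔) =
  (λ x → r x % 2 ≢ ζ % 2) , RankedD⇒D (r , rk , λ _ → ⇔-refl) ,
  λ x → mk⇔ (λ a n → n (to (A⇔ x) a)) (λ n → from (A⇔ x) (decidable-stable (r x % 2 ≟ ζ % 2) n))

IsRank-weaken : ∀ {ζ ζ′ r} → ζ ≤ ζ′ → IsRank ζ r → IsRank ζ′ r
IsRank-weaken ζ≤ζ′ rk = (λ x → ≤-trans (proj₁ rk x) ζ≤ζ′) , λ η _ → IsRank-open-≤ rk η

IsRank-const : ∀ {ζ c} → c ≤ ζ → IsRank ζ (λ _ → c)
IsRank-const {c = c} c≤ζ = (λ _ → c≤ζ) , λ η _ → Open-const (c ≤ η)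

IsRank-suc : ∀ {ζ r} → IsRank ζ r → IsRank (suc ζ) (λ x → suc (r x))
IsRank-suc rk = (λ x → s≤s (proj₁ rk x)) , λ η _ → IsRank-open-< rk η

up : ℕ → ℕ → ℕ
up c r with suc r % 2 ≟ c
... | yes _ = suc (suc r)
... | no _ = suc r

up-%2 : ∀ c r → up c r % 2 ≢ c
up-%2 c r with suc r % 2 ≟ c
... | yes e = λ e′ → suc-%2≢ r (trans e (sym e′))
... | no ne = ne

up-≤ : ∀ c r → up c r ≤ suc (suc r)
up-≤ c r with suc r % 2 ≟ c
... | yes _ = ≤-refl
... | no _ = n≤1+n _

up-≥ : ∀ c r → r ≤ up c r
up-≥ c r with suc r % 2 ≟ c
... | yes _ = ≤-trans (n≤1+n r) (n≤1+n (suc r))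
... | no _ = n≤1+n r

UpBound : ℕ → ℕ → ℕ → Set
UpBound c η r with η % 2 ≟ c
... | yes _ = suc (suc r) ≤ η
... | no _ = suc r ≤ η

-- A bound η of the parity c is never hit by up c r.
up-≤⇔ : ∀ c η r → (up c r ≤ η) ⇔ UpBound c η r
up-≤⇔ c η r with η % 2 ≟ c | suc r % 2 ≟ c
... | yes _ | yes _ = ⇔-refl
... | yes η≡ | no r≢ =
  mk⇔ (λ p → ≤∧≢⇒< p (λ e → r≢ (trans (cong (_% 2) e) η≡))) (≤-trans (n≤1+n _))
... | no η≢ | yes r≡ =
  mk⇔ (≤-trans (n≤1+n _)) (λ p → ≤∧≢⇒< p (λ e → η≢ (trans (cong (_% 2) (sym e)) r≡)))
... | no _ | no _ = ⇔-refl

IsRank-up : ∀ {ζ r} c → IsRank ζ r → IsRank (suc (suc ζ)) (λ x → up c (r x))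
IsRank-up {r = r} c rk = (λ x → ≤-trans (up-≤ c (r x)) (s≤s (s≤s (proj₁ rk x)))) ,
  λ η _ → Open-resp-⇔ (λ x → ⇔-sym (up-≤⇔ c η (r x))) (UpBound-open η)
  where
  UpBound-open : ∀ η → Open (λ x → UpBound c η (r x))
  UpBound-open η with η % 2 ≟ c
  ... | yes _ = IsRank-open-< (IsRank-suc rk) η
  ... | no _ = IsRank-open-< rk η

D-resp : ∀ {ζ A B} → (∀ x → A x ⇔ B x) → D ζ A → D ζ B
D-resp A⇔B (O , O-open , O-inc , A⇔) = O , O-open , O-inc , λ x → ⇔-trans (⇔-sym (A⇔B x)) (A⇔ x)

Dˇ-resp : ∀ {ζ A B} → (∀ x → A x ⇔ B x) → Dˇ ζ A → Dˇ ζ B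
Dˇ-resp A⇔B (C , dC , A⇔) = C , dC , λ x → ⇔-trans (⇔-sym (A⇔B x)) (A⇔ x)

D-preimage : ∀ {ζ A f} → Continuous f → D ζ A → D ζ (λ x → A (f x))
D-preimage {f = f} cf (O , O-open , O-inc , A⇔) =
  (λ η x → O η (f x)) , (λ η l → Open-preimage {f = f} cf (O-open η l)) ,
  (λ θ η l l′ x → O-inc θ η l l′ (f x)) , λ x → A⇔ (f x)

Dˇ-preimage : ∀ {ζ A f} → Continuous f → Dˇ ζ A → Dˇ ζ (λ x → A (f x))
Dˇ-preimage {f = f} cf (C , dC , A⇔) = (λ x → C (f x)) , D-preimage cf dC , λ x → A⇔ (f x)

×-⊎-distrib : ∀ {a b c r : Set} → (((a × c) ⊎ (b × ¬ c)) × r) ⇔ (((a × r) × c) ⊎ ((b × r) × ¬ c))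
×-⊎-distrib = mk⇔
  (λ { (inj₁ (a , c) , r) → inj₁ ((a , r) , c) ; (inj₂ (b , ¬c) , r) → inj₂ ((b , r) , ¬c) })
  (λ { (inj₁ ((a , r) , c)) → inj₁ (a , c) , r ; (inj₂ ((b , r) , ¬c)) → inj₂ (b , ¬c) , r })

⊕-coDifference : ∀ {a b a₁ b₁ ua va ub vb c : Set} →
  a ⇔ (a₁ × ¬ (ua × ¬ va)) → b ⇔ (b₁ × ¬ (ub × ¬ vb)) →
  ((a × c) ⊎ (b × ¬ c)) ⇔
  (((a₁ × c) ⊎ (b₁ × ¬ c)) × ¬ (((ua × c) ⊎ (ub × ¬ c)) × ¬ ((va × c) ⊎ (vb × ¬ c))))
⊕-coDifference a⇔ b⇔ = mk⇔
  (λ { (inj₁ (a , c)) → let (a₁ , n) = to a⇔ a in inj₁ (a₁ , c) ,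
         λ { (inj₁ (ua , _) , ¬v) → n (ua , λ va → ¬v (inj₁ (va , c)))
           ; (inj₂ (_ , ¬c) , _) → ¬c c }
     ; (inj₂ (b , ¬c)) → let (b₁ , n) = to b⇔ b in inj₂ (b₁ , ¬c) ,
         λ { (inj₁ (_ , c) , _) → ¬c c
           ; (inj₂ (ub , _) , ¬v) → n (ub , λ vb → ¬v (inj₂ (vb , ¬c))) } })
  (λ { (inj₁ (a₁ , c) , n) → inj₁ (from a⇔ (a₁ , λ (ua , ¬va) →
         n (inj₁ (ua , c) , λ { (inj₁ (va , _)) → ¬va va ; (inj₂ (_ , ¬c)) → ¬c c })) , c)
     ; (inj₂ (b₁ , ¬c) , n) → inj₂ (from b⇔ (b₁ , λ (ub , ¬vb) →
         n (inj₂ (ub , ¬c) , λ { (inj₁ (_ , c)) → ¬c c ; (inj₂ (vb , _)) → ¬vb vb })) , ¬c) })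

CoDifferenceDecomposition : Class → Pred → Set₁
CoDifferenceDecomposition Γ B = Σ Pred λ A → Σ Pred λ U → Σ Pred λ V →
  Γ A × Open U × Open V × (∀ x → V x → U x) × (∀ x → B x ⇔ (A x × ¬ (U x × ¬ V x)))

⊕-decompose : ∀ {Γ Λ C A B X} → Clopen C →
  CoDifferenceDecomposition Γ A → CoDifferenceDecomposition Λ B →
  (∀ x → X x ⇔ ((A x × C x) ⊎ (B x × ¬ C x))) → CoDifferenceDecomposition (Γ ⊕ Λ) X
⊕-decompose {C = C} (oC , o¬C)
  (A₁ , UA , VA , dA₁ , oUA , oVA , VA⊆UA , A⇔) (B₁ , UB , VB , dB₁ , oUB , oVB , VB⊆UB , B⇔) X⇔ =
  (λ x → (A₁ x × C x) ⊎ (B₁ x × ¬ C x)) ,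
  (λ x → (UA x × C x) ⊎ (UB x × ¬ C x)) ,
  (λ x → (VA x × C x) ⊎ (VB x × ¬ C x)) ,
  (C , A₁ , B₁ , (oC , o¬C) , dA₁ , dB₁ , λ x → ⇔-refl) ,
  Open-∪ (Open-∩ oUA oC) (Open-∩ oUB o¬C) , Open-∪ (Open-∩ oVA oC) (Open-∩ oVB o¬C) ,
  (λ x → [ (λ (v , c) → inj₁ (VA⊆UA x v , c)) , (λ (v , ¬c) → inj₂ (VB⊆UB x v , ¬c)) ]) ,
  λ x → ⇔-trans (X⇔ x) (⊕-coDifference (A⇔ x) (B⇔ x))

risesAt : (ℕ → Bool) → ℕ → Bool
risesAt t zero = t 0
risesAt t (suc i) = t (suc i) ∧ not (t i)

Monotone : (ℕ → Bool) → Set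
Monotone t = ∀ i → t i ≡ true → t (suc i) ≡ true

Monotone-≤ : ∀ {t} → Monotone t → ∀ {i j} → i ≤ j → t i ≡ true → t j ≡ true
Monotone-≤ m i≤j e with m≤n⇒m<n∨m≡n i≤j
... | inj₂ refl = e
... | inj₁ (s≤s i≤j′) = m _ (Monotone-≤ m i≤j′ e)

risesAt⇒true : ∀ t i → risesAt t i ≡ true → t i ≡ true
risesAt⇒true t zero e = e
risesAt⇒true t (suc i) e with t (suc i)
... | true = refl
... | false = e

risesAt⇒false-before : ∀ t i → risesAt t (suc i) ≡ true → t i ≡ false
risesAt⇒false-before t i e with t (suc i) | t i
... | true | false = refl
... | true | true = ⊥-elim (true≢false (sym e))
... | false | _ = ⊥-elim (true≢false (sym e))

risesAt-least : ∀ {t} → Monotone t → ∀ i j → risesAt t i ≡ true → t j ≡ true → i ≤ j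
risesAt-least m zero j _ _ = z≤n
risesAt-least {t} m (suc i) j e tj with suc i ≤? j
... | yes l = l
... | no l =
  ⊥-elim (true≢false (trans (sym (Monotone-≤ m (≤-pred (≰⇒> l)) tj)) (risesAt⇒false-before t i e)))

risesAt-unique : ∀ {t} → Monotone t → ∀ i j → risesAt t i ≡ true → risesAt t j ≡ true → i ≡ j
risesAt-unique {t} m i j ei ej =
  ≤-antisym (risesAt-least m i j ei (risesAt⇒true t j ej)) (risesAt-least m j i ej (risesAt⇒true t i ei))

rises : ∀ t n → t n ≡ true → ∃[ i ] (risesAt t i ≡ true)
rises t zero e = 0 , e
rises t (suc n) e with t n in tn
... | true = rises t n tn
... | false = suc n , cong₂ _∧_ e (cong not tn)

risesAt-cong : ∀ t t′ i → (∀ k → k ≤ i → t k ≡ t′ k) → risesAt t i ≡ risesAt t′ i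
risesAt-cong t t′ zero f = f 0 z≤n
risesAt-cong t t′ (suc i) f = cong₂ _∧_ (f (suc i) ≤-refl) (cong not (f i (n≤1+n i)))

never-risesAt : ∀ t → (∀ i → t i ≡ false) → ∀ i → risesAt t i ≡ false
never-risesAt t f i = ¬-not (λ e → true≢false (trans (sym (risesAt⇒true t i e)) (f i)))

riseMarks : (ℕ → Bool) → (ℕ → Bool) → ℕ → Bool
riseMarks t u zero = risesAt t 0
riseMarks t u (suc i) = risesAt t (suc i) ∨ risesAt u i

riseMarks-left : ∀ t u i → risesAt t i ≡ true → riseMarks t u i ≡ true
riseMarks-left t u zero e = e
riseMarks-left t u (suc i) e rewrite e = refl

riseMarks-right : ∀ t u i → risesAt u i ≡ true → riseMarks t u (suc i) ≡ true
riseMarks-right t u i e rewrite e = ∨-zeroʳ _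

riseMarks-only-left : ∀ t u → (∀ i → u i ≡ false) → ∀ k → riseMarks t u k ≡ true → risesAt t k ≡ true
riseMarks-only-left t u u-false zero e = e
riseMarks-only-left t u u-false (suc i) e with risesAt t (suc i)
... | true = refl
... | false = ⊥-elim (true≢false (trans (sym e) (never-risesAt u u-false i)))

riseMarks-never : ∀ t u → (∀ i → t i ≡ false) → (∀ i → u i ≡ false) → ∀ i → riseMarks t u i ≡ false
riseMarks-never t u t-false u-false zero = never-risesAt t t-false 0
riseMarks-never t u t-false u-false (suc i)
  rewrite never-risesAt t t-false (suc i) | never-risesAt u u-false i = refl

riseMarks-cong : ∀ t t′ u u′ i → (∀ k → k ≤ i → t k ≡ t′ k) → (∀ k → k < i → u k ≡ u′ k) →
  riseMarks t u i ≡ riseMarks t′ u′ i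
riseMarks-cong t t′ u u′ zero ft fu = ft 0 z≤n
riseMarks-cong t t′ u u′ (suc i) ft fu =
  cong₂ _∨_ (risesAt-cong t t′ (suc i) ft) (risesAt-cong u u′ i (λ k k≤i → fu k (s≤s k≤i)))

module _ (cl : Classical) where
  -- least P n: the least i < n with P i, or n if there is none.
  least : (ℕ → Set) → ℕ → ℕ
  least P zero = 0
  least P (suc n) = [ (λ _ → 0) , (λ _ → suc (least (λ i → P (suc i)) n)) ] (cl (P 0))

  least-≤ : ∀ P n → least P n ≤ n
  least-≤ P zero = z≤n
  least-≤ P (suc n) with cl (P 0)
  ... | inj₁ _ = z≤n
  ... | inj₂ _ = s≤s (least-≤ _ n)

  least-minimal : ∀ P n i → i < least P n → ¬ P i
  least-minimal P (suc n) i l with cl (P 0)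
  least-minimal P (suc n) zero l | inj₂ ¬P0 = ¬P0
  least-minimal P (suc n) (suc i) (s≤s l) | inj₂ _ = least-minimal (λ j → P (suc j)) n i l

  least-holds : ∀ P n → least P n < n → P (least P n)
  least-holds P (suc n) l with cl (P 0)
  ... | inj₁ P0 = P0
  ... | inj₂ _ = least-holds (λ j → P (suc j)) n (≤-pred l)

  least-≤-witness : ∀ P n i → i < n → P i → least P n ≤ i
  least-≤-witness P n i l p with least P n ≤? i
  ... | yes q = q
  ... | no q = ⊥-elim (least-minimal P n i (≰⇒> q) p)

  D⇒RankedD : ∀ {ζ A} → D ζ A → RankedD ζ A
  D⇒RankedD {ζ} {A} (O , O-open , O-inc , A⇔) = r , (bounded , open≤) , λ x → mk⇔ (into x) (outof x)
    where
    r : Cantor → ℕ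
    r x = least (λ η → O η x) ζ
    bounded : ∀ x → r x ≤ ζ
    bounded x = least-≤ _ ζ
    open≤ : ∀ η → η < ζ → Open (λ x → r x ≤ η)
    open≤ η l = Open-resp-⇔
      (λ x → mk⇔ (least-≤-witness _ ζ η l) (λ p → O-inc (r x) η p l x (least-holds _ ζ (≤-<-trans p l))))
      (O-open η l)
    into : ∀ x → A x → r x % 2 ≢ ζ % 2
    into x a with to (A⇔ x) a
    ... | (η , l , η≢ , p , before) = subst (λ z → z % 2 ≢ ζ % 2) (sym r≡η) η≢
      where
      r≡η : r x ≡ η
      r≡η with m≤n⇒m<n∨m≡n (least-≤-witness _ ζ η l p)
      ... | inj₁ l′ = ⊥-elim (before (r x) l′ (least-holds _ ζ (<-trans l′ l)))
      ... | inj₂ q = q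
    outof : ∀ x → r x % 2 ≢ ζ % 2 → A x
    outof x r≢ = from (A⇔ x) (r x , r<ζ , r≢ , least-holds _ ζ r<ζ , λ θ l → least-minimal _ ζ θ l)
      where
      r<ζ : r x < ζ
      r<ζ = ≤∧≢⇒< (bounded x) (λ e → r≢ (cong (_% 2) e))

  Dˇ⇒RankedDˇ : ∀ {ζ A} → Dˇ ζ A → RankedDˇ ζ A
  Dˇ⇒RankedDˇ {ζ} (B , dB , A⇔) with D⇒RankedD dB
  ... | (r , rk , B⇔) = r , rk , λ x → mk⇔
      (λ a → decidable-stable (r x % 2 ≟ ζ % 2) (λ r≢ → to (A⇔ x) a (from (B⇔ x) r≢)))
      (λ r≡ → from (A⇔ x) (λ b → to (B⇔ x) b r≡))

  select : Pred → (Cantor → ℕ) → (Cantor → ℕ) → Cantor → ℕ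
  select V f g x = [ (λ _ → f x) , (λ _ → g x) ] (cl (V x))

  IsRank-select : ∀ {ζ V f g} → Open V → IsRank ζ f → IsRank ζ g → (∀ x → f x ≤ g x) →
    IsRank ζ (select V f g)
  IsRank-select {ζ} {V} {f} {g} oV rf rg f≤g = bounded ,
    λ η l → Open-resp-⇔ (λ x → mk⇔ (into η x) (outof η x))
              (Open-∪ (Open-∩ oV (IsRank-open-≤ rf η)) (proj₂ rg η l))
    where
    bounded : ∀ x → select V f g x ≤ ζ
    bounded x with cl (V x)
    ... | inj₁ _ = proj₁ rf x
    ... | inj₂ _ = proj₁ rg x
    into : ∀ η x → (V x × f x ≤ η) ⊎ g x ≤ η → select V f g x ≤ η
    into η x p with cl (V x) | p
    ... | inj₁ _ | inj₁ (_ , f≤η) = f≤η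
    ... | inj₁ _ | inj₂ g≤η = ≤-trans (f≤g x) g≤η
    ... | inj₂ ¬v | inj₁ (v , _) = ⊥-elim (¬v v)
    ... | inj₂ _ | inj₂ g≤η = g≤η
    outof : ∀ η x → select V f g x ≤ η → (V x × f x ≤ η) ⊎ g x ≤ η
    outof η x p with cl (V x)
    ... | inj₁ v = inj₁ (v , p)
    ... | inj₂ _ = inj₂ p

  Dˇ-∩-Open : ∀ {ζ A U} → Dˇ ζ A → Open U → D (suc ζ) (λ x → A x × U x)
  Dˇ-∩-Open {ζ} {A} {U} dA oU with Dˇ⇒RankedDˇ dA
  ... | (r , rk , A⇔) = RankedD⇒D (select U r (λ _ → suc ζ) ,
    IsRank-select oU (IsRank-weaken (n≤1+n ζ) rk) (IsRank-const ≤-refl) (λ x → m≤n⇒m≤1+n (proj₁ rk x)) , ∩⇔)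
    where
    ∩⇔ : ∀ x → (A x × U x) ⇔ (select U r (λ _ → suc ζ) x % 2 ≢ suc ζ % 2)
    ∩⇔ x with cl (U x)
    ... | inj₁ u = mk⇔ (λ (a , _) → from (≢suc-%2⇔≡ (r x) ζ) (to (A⇔ x) a))
                       (λ r≢ → from (A⇔ x) (to (≢suc-%2⇔≡ (r x) ζ) r≢) , u)
    ... | inj₂ ¬u = mk⇔ (λ (_ , u) → ⊥-elim (¬u u)) (λ r≢ → ⊥-elim (r≢ refl))

  D-suc-decompose : ∀ {ζ B} → D (suc ζ) B →
    Σ Pred λ A → Σ Pred λ U → Dˇ ζ A × Open U × (∀ x → B x ⇔ (A x × U x))
  D-suc-decompose {ζ} dB with D⇒RankedD dB
  ... | (r , rk , B⇔) =
    (λ x → (r x ⊓ ζ) % 2 ≡ ζ % 2) , (λ x → r x ≤ ζ) ,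
    RankedDˇ⇒Dˇ ((λ x → r x ⊓ ζ) , IsRank-⊓ (n≤1+n ζ) rk , λ _ → ⇔-refl) ,
    proj₂ rk ζ (n<1+n ζ) , λ x → ⇔-trans (B⇔ x) (split x)
    where
    split : ∀ x → (r x % 2 ≢ suc ζ % 2) ⇔ (((r x ⊓ ζ) % 2 ≡ ζ % 2) × r x ≤ ζ)
    split x with r x ≤? ζ
    ... | yes r≤ζ rewrite m≤n⇒m⊓n≡m r≤ζ =
      mk⇔ (λ r≢ → to (≢suc-%2⇔≡ (r x) ζ) r≢ , r≤ζ) (λ (r≡ , _) → from (≢suc-%2⇔≡ (r x) ζ) r≡)
    ... | no r≰ζ rewrite ≤-antisym (proj₁ rk x) (≰⇒> r≰ζ) =
      mk⇔ (λ r≢ → ⊥-elim (r≢ refl)) (λ (_ , ζ<ζ) → ⊥-elim (<-irrefl refl ζ<ζ))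

  Dˇ-∩-Closed : ∀ {ζ A V} → ζ % 2 ≡ 0 → Dˇ ζ A → Open V → Dˇ (suc ζ) (λ x → A x × ¬ V x)
  Dˇ-∩-Closed {ζ} {A} {V} ζ-even dA oV with Dˇ⇒RankedDˇ dA
  ... | (r , rk , A⇔) = RankedDˇ⇒Dˇ (select V (λ _ → 0) (λ x → suc (r x)) ,
    IsRank-select oV (IsRank-const z≤n) (IsRank-suc rk) (λ _ → z≤n) , ∩⇔)
    where
    ∩⇔ : ∀ x → (A x × ¬ V x) ⇔ (select V (λ _ → 0) (λ x → suc (r x)) x % 2 ≡ suc ζ % 2)
    ∩⇔ x with cl (V x)
    ... | inj₁ v =
      mk⇔ (λ (_ , ¬v) → ⊥-elim (¬v v)) (λ 0≡ → ⊥-elim (0≢1 (trans 0≡ (suc-%2-of-even ζ ζ-even))))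
    ... | inj₂ ¬v = mk⇔ (λ (a , _) → from (suc-%2⇔ (r x) ζ) (to (A⇔ x) a))
                        (λ r≡ → from (A⇔ x) (to (suc-%2⇔ (r x) ζ) r≡) , ¬v)

  Dˇ-suc-decompose : ∀ {ζ B} → ζ % 2 ≡ 0 → Dˇ (suc ζ) B →
    Σ Pred λ A → Σ Pred λ V → Dˇ ζ A × Open V × (∀ x → B x ⇔ (A x × ¬ V x))
  Dˇ-suc-decompose {ζ} ζ-even dB with Dˇ⇒RankedDˇ dB
  ... | (r , rk , B⇔) =
    (λ x → pred (r x) % 2 ≡ ζ % 2) , (λ x → r x ≤ 0) ,
    RankedDˇ⇒Dˇ ((λ x → pred (r x)) , IsRank-pred rk , λ _ → ⇔-refl) ,
    proj₂ rk 0 (s≤s z≤n) , λ x → ⇔-trans (B⇔ x) (split (r x))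
    where
    split : ∀ n → (n % 2 ≡ suc ζ % 2) ⇔ ((pred n % 2 ≡ ζ % 2) × ¬ n ≤ 0)
    split zero =
      mk⇔ (λ 0≡ → ⊥-elim (0≢1 (trans 0≡ (suc-%2-of-even ζ ζ-even)))) (λ (_ , n≰0) → ⊥-elim (n≰0 z≤n))
    split (suc n) = mk⇔ (λ e → to (suc-%2⇔ n ζ) e , λ ()) (λ (e , _) → from (suc-%2⇔ n ζ) e)

  -- t = r on V, r + 2 off U, and on U ∖ V the next value above r whose parity is not c.
  parity-∩-coDifference : ∀ {ζ r U V} c → IsRank ζ r → Open U → Open V →
    Σ (Cantor → ℕ) λ t → IsRank (suc (suc ζ)) t × (∀ x → (r x % 2 ≡ c × ¬ (U x × ¬ V x)) ⇔ (t x % 2 ≡ c))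
  parity-∩-coDifference {ζ} {r} {U} {V} c rk oU oV =
    select V r outer , IsRank-select oV (IsRank-weaken (m≤n+m ζ 2) rk) outer-rank r≤outer , ∩⇔
    where
    outer : Cantor → ℕ
    outer = select U (λ x → up c (r x)) (λ x → suc (suc (r x)))
    outer-rank : IsRank (suc (suc ζ)) outer
    outer-rank = IsRank-select oU (IsRank-up c rk) (IsRank-suc (IsRank-suc rk)) (λ x → up-≤ c (r x))
    r≤outer : ∀ x → r x ≤ outer x
    r≤outer x with cl (U x)
    ... | inj₁ _ = up-≥ c (r x)
    ... | inj₂ _ = ≤-trans (n≤1+n (r x)) (n≤1+n (suc (r x)))
    ∩⇔ : ∀ x → (r x % 2 ≡ c × ¬ (U x × ¬ V x)) ⇔ (select V r outer x % 2 ≡ c)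
    ∩⇔ x with cl (V x) | cl (U x)
    ... | inj₁ v | _ = mk⇔ proj₁ (λ r≡ → r≡ , λ (_ , ¬v) → ¬v v)
    ... | inj₂ ¬v | inj₁ u = mk⇔ (λ (_ , n) → ⊥-elim (n (u , ¬v))) (λ e → ⊥-elim (up-%2 c (r x) e))
    ... | inj₂ _ | inj₂ ¬u = mk⇔ proj₁ (λ r≡ → r≡ , λ (u , _) → ¬u u)

  Dˇ-∩-coDifference : ∀ {ζ A U V} → Dˇ ζ A → Open U → Open V →
    Dˇ (suc (suc ζ)) (λ x → A x × ¬ (U x × ¬ V x))
  Dˇ-∩-coDifference {ζ} dA oU oV with Dˇ⇒RankedDˇ dA
  ... | (r , rk , A⇔) with parity-∩-coDifference (ζ % 2) rk oU oV
  ...   | (t , rt , t⇔) = RankedDˇ⇒Dˇ (t , rt , λ x → ⇔-trans (A⇔ x ×-⇔ ⇔-refl) (t⇔ x))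

  D-∩-coDifference : ∀ {ζ A U V} → D ζ A → Open U → Open V →
    D (suc (suc ζ)) (λ x → A x × ¬ (U x × ¬ V x))
  D-∩-coDifference {ζ} dA oU oV with D⇒RankedD dA
  ... | (r , rk , A⇔) with parity-∩-coDifference (suc ζ % 2) rk oU oV
  ...   | (t , rt , t⇔) = RankedD⇒D (t , rt , λ x →
    ⇔-trans (⇔-trans (A⇔ x) (≢-%2⇔≡suc (r x) ζ) ×-⇔ ⇔-refl)
            (⇔-trans (t⇔ x) (⇔-sym (≢-%2⇔≡suc (t x) (suc (suc ζ))))))

  Dˇ-suc-suc-decompose : ∀ {ζ B} → Dˇ (suc (suc ζ)) B → CoDifferenceDecomposition (Dˇ ζ) B
  Dˇ-suc-suc-decompose {ζ} dB with Dˇ⇒RankedDˇ dB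
  ... | (r , rk , B⇔) =
    (λ x → (r x ⊓ ζ) % 2 ≡ ζ % 2) , (λ x → r x ≤ suc ζ) , (λ x → r x ≤ ζ) ,
    RankedDˇ⇒Dˇ ((λ x → r x ⊓ ζ) , IsRank-⊓ (m≤n+m ζ 2) rk , λ _ → ⇔-refl) ,
    proj₂ rk (suc ζ) ≤-refl , proj₂ rk ζ (m<n+m ζ (s≤s z≤n)) , (λ x → m≤n⇒m≤1+n) ,
    λ x → ⇔-trans (B⇔ x) (split x)
    where
    split : ∀ x → (r x % 2 ≡ ζ % 2) ⇔ (((r x ⊓ ζ) % 2 ≡ ζ % 2) × ¬ (r x ≤ suc ζ × ¬ r x ≤ ζ))
    split x with r x ≤? ζ | r x ≤? suc ζ
    ... | yes r≤ζ | _ rewrite m≤n⇒m⊓n≡m r≤ζ = mk⇔ (λ e → e , λ (_ , r≰ζ) → r≰ζ r≤ζ) proj₁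
    ... | no r≰ζ | yes r≤1+ζ rewrite ≤-antisym r≤1+ζ (≰⇒> r≰ζ) =
      mk⇔ (λ e → ⊥-elim (suc-%2≢ ζ e)) (λ (_ , n) → ⊥-elim (n (≤-refl , λ l → <-irrefl refl l)))
    ... | no _ | no r≰1+ζ rewrite ≤-antisym (proj₁ rk x) (≰⇒> r≰1+ζ) | m≥n⇒m⊓n≡n (m≤n+m ζ 2) =
      mk⇔ (λ _ → refl , λ (l , _) → <-irrefl refl l) (λ _ → refl)

  D-suc-suc-decompose : ∀ {ζ B} → ζ % 2 ≡ 1 → D (suc (suc ζ)) B → CoDifferenceDecomposition (D ζ) B
  D-suc-suc-decompose {ζ} ζ-odd dB with D⇒RankedD dB
  ... | (r , rk , B⇔) =
    (λ x → pred (pred (r x)) % 2 ≢ ζ % 2) , (λ x → r x ≤ 1) , (λ x → r x ≤ 0) ,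
    RankedD⇒D ((λ x → pred (pred (r x))) , IsRank-pred (IsRank-pred rk) , λ _ → ⇔-refl) ,
    proj₂ rk 1 (s≤s (s≤s z≤n)) , proj₂ rk 0 (s≤s z≤n) , (λ x r≤0 → ≤-trans r≤0 z≤n) ,
    λ x → ⇔-trans (B⇔ x) (split (r x))
    where
    split : ∀ n → (n % 2 ≢ ζ % 2) ⇔ ((pred (pred n) % 2 ≢ ζ % 2) × ¬ (n ≤ 1 × ¬ n ≤ 0))
    split zero = mk⇔ (λ n → n , λ (_ , n≰0) → n≰0 z≤n) proj₁
    split (suc zero) = mk⇔ (λ 1≢ → ⊥-elim (1≢ (sym ζ-odd))) (λ (_ , n) → ⊥-elim (n (≤-refl , λ ())))
    split (suc (suc n)) = mk⇔ (λ n≢ → n≢ , λ (l , _) → ≤⇒≯ l (s≤s (s≤s z≤n))) proj₁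

  -- Lipschitz reductions to Q₀, AllZero and Q₂

  Forced : Pred → Cantor → ℕ → Set
  Forced U x n = ∀ β → Agree n x β → U β

  forced? : Pred → Cantor → ℕ → Bool
  forced? U x n = [ (λ _ → true) , (λ _ → false) ] (cl (Forced U x n))

  forced?-sound : ∀ {U x n} → forced? U x n ≡ true → Forced U x n
  forced?-sound {U} {x} {n} e with cl (Forced U x n)
  ... | inj₁ f = f

  forced?-complete : ∀ {U x n} → Forced U x n → forced? U x n ≡ true
  forced?-complete {U} {x} {n} f with cl (Forced U x n)
  ... | inj₁ _ = refl
  ... | inj₂ ¬f = ⊥-elim (¬f f)

  forced?-Agree : ∀ U {x y} n → Agree n x y → forced? U x n ≡ forced? U y n
  forced?-Agree U {x} {y} n a with cl (Forced U x n) | cl (Forced U y n)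
  ... | inj₁ _ | inj₁ _ = refl
  ... | inj₁ f | inj₂ ¬f = ⊥-elim (¬f λ β a′ → f β (Agree-trans a a′))
  ... | inj₂ ¬f | inj₁ f = ⊥-elim (¬f λ β a′ → f β (Agree-trans (Agree-sym a) a′))
  ... | inj₂ _ | inj₂ _ = refl

  forced?-suc : ∀ U x n → forced? U x n ≡ true → forced? U x (suc n) ≡ true
  forced?-suc U x n e = forced?-complete λ β a → forced?-sound e β (Agree-mono (n≤1+n n) a)

  forced?-outside : ∀ {U x} → ¬ U x → ∀ n → forced? U x n ≡ false
  forced?-outside {U} {x} ¬u n = ¬-not (λ e → ¬u (forced?-sound e x (λ i l → refl)))

  forced?-Lipschitz : ∀ U {x y n i} → i < n → Agree n x y → forced? U x i ≡ forced? U y i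
  forced?-Lipschitz U {i = i} i<n a = forced?-Agree U i (Agree-mono (<⇒≤ i<n) a)

  Open⇒forced : ∀ {U} → Open U → ∀ x → U x → ∃[ n ] (forced? U x n ≡ true)
  Open⇒forced oU x u = let (n , f) = oU x u in n , forced?-complete f

  Reduces-Lipschitz : Pred → Pred → Set
  Reduces-Lipschitz B Q = Σ (Cantor → Cantor) λ h → Lipschitz h × (∀ x → B x ⇔ Q (h x))

  Open-reduces-Q₀ : ∀ {U} → Open U → Reduces-Lipschitz U Q₀
  Open-reduces-Q₀ {U} oU = h , h-Lipschitz , λ x → mk⇔ (λ u → inj₂ (Open⇒forced oU x u)) (outof x)
    where
    h : Cantor → Cantor
    h x zero = true
    h x (suc i) = forced? U x i
    h-Lipschitz : Lipschitz h
    h-Lipschitz α β n a zero l = refl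
    h-Lipschitz α β n a (suc i) l = forced?-Lipschitz U (≤-trans (n≤1+n (suc i)) l) a
    outof : ∀ x → Q₀ (h x) → U x
    outof x (inj₂ (i , e)) = forced?-sound e x (λ _ _ → refl)

  Open-reduces-AllZero : ∀ {V} → Open V → Reduces-Lipschitz (λ x → ¬ V x) AllZero
  Open-reduces-AllZero {V} oV = forced? V , (λ α β n a i l → forced?-Lipschitz V l a) ,
    λ x → mk⇔ (λ ¬v → forced?-outside ¬v)
      (λ z v → let (n , e) = Open⇒forced oV x v in true≢false (trans (sym e) (z n)))

  -- h x gets a 1 when U becomes forced and another one right after V does:
  -- two 1s if x ∈ V, exactly one if x ∈ U ∖ V, none if x ∉ U.
  coDifference-reduces-Q₂ : ∀ {U V} → Open U → Open V → (∀ x → V x → U x) →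
    Reduces-Lipschitz (λ x → ¬ (U x × ¬ V x)) Q₂
  coDifference-reduces-Q₂ {U} {V} oU oV V⊆U = h , h-Lipschitz , λ x → mk⇔ (into x) (outof x)
    where
    h : Cantor → Cantor
    h x = riseMarks (forced? U x) (forced? V x)

    h-Lipschitz : Lipschitz h
    h-Lipschitz α β n a i l = riseMarks-cong _ _ _ _ i
      (λ k k≤i → forced?-Lipschitz U (≤-<-trans k≤i l) a) (λ k k<i → forced?-Lipschitz V (<-trans k<i l) a)

    into : ∀ x → ¬ (U x × ¬ V x) → Q₂ (h x)
    into x n with cl (V x)
    ... | inj₁ v =
      let (nV , eV) = Open⇒forced oV x v
          (iV , rV) = rises (forced? V x) nV eV
          U-at-iV = forced?-complete (λ β a → V⊆U β (forced?-sound (risesAt⇒true _ iV rV) β a))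
          (iU , rU) = rises (forced? U x) iV U-at-iV
      in inj₂ (iU , suc iV , s≤s (risesAt-least (forced?-suc U x) iU iV rU U-at-iV) ,
               riseMarks-left (forced? U x) (forced? V x) iU rU ,
               riseMarks-right (forced? U x) (forced? V x) iV rV)
    ... | inj₂ ¬v =
      inj₁ (riseMarks-never (forced? U x) (forced? V x) (forced?-outside (λ u → n (u , ¬v))) (forced?-outside ¬v))

    outof : ∀ x → Q₂ (h x) → ¬ (U x × ¬ V x)
    outof x (inj₁ z) (u , _) =
      let (n , e) = Open⇒forced oU x u ; (i , r) = rises (forced? U x) n e in
      true≢false (trans (sym (riseMarks-left (forced? U x) (forced? V x) i r)) (z i))
    outof x (inj₂ (i , j , i<j , hi , hj)) (_ , ¬v) =
      <-irrefl (risesAt-unique (forced?-suc U x) i j (only-U i hi) (only-U j hj)) i<j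
      where
      only-U : ∀ k → h x k ≡ true → risesAt (forced? U x) k ≡ true
      only-U = riseMarks-only-left (forced? U x) (forced? V x) (forced?-outside ¬v)

  Q₂⇔¬exactlyOne : ∀ s → Q₂ s ⇔ (¬ (SomeOne s × ¬ TwoOnes s))
  Q₂⇔¬exactlyOne s = mk⇔ into outof
    where
    into : Q₂ s → ¬ (SomeOne s × ¬ TwoOnes s)
    into (inj₁ z) (one , _) = AllZero⇒¬SomeOne z one
    into (inj₂ two) (_ , ¬two) = ¬two two
    outof : ¬ (SomeOne s × ¬ TwoOnes s) → Q₂ s
    outof n with cl (TwoOnes s)
    ... | inj₁ two = inj₂ two
    ... | inj₂ ¬two = inj₁ (¬SomeOne⇒AllZero (λ one → n (one , ¬two)))

  L₀-complete : ∀ {ζ L} → Complete (Dˇ ζ) (OmegaPower L) → Complete (D (suc ζ)) (OmegaPower (L₀ L))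
  L₀-complete {L = L} (L∞∈ , L∞-hard) =
    D-resp (λ α → ⇔-sym (L₀-splits cl L α))
      (Dˇ-∩-Open (Dˇ-preimage evens∞-continuous L∞∈) (Open-odds∞ Q₀-open)) ,
    λ B dB → let (A , U , dA , oU , B⇔) = D-suc-decompose dB
                 (h , h-lip , h-red) = Open-reduces-Q₀ oU in
      Reduces-interleave∞ (L₀ L) L (L₀-splits cl L) Q₀-resp-≗ (L∞-hard A dA) h-lip h-red B⇔

  L₁-complete : ∀ {ζ L} → ζ % 2 ≡ 0 →
    Complete (Dˇ ζ) (OmegaPower L) → Complete (Dˇ (suc ζ)) (OmegaPower (L₁ L))
  L₁-complete {L = L} ζ-even (L∞∈ , L∞-hard) =
    Dˇ-resp (λ α → ⇔-sym (⇔-trans (L₁-splits L α) (⇔-refl ×-⇔ AllZero⇔¬SomeOne (odds∞ α))))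
      (Dˇ-∩-Closed ζ-even (Dˇ-preimage evens∞-continuous L∞∈) (Open-odds∞ SomeOne-open)) ,
    λ B dB → let (A , V , dA , oV , B⇔) = Dˇ-suc-decompose ζ-even dB
                 (h , h-lip , h-red) = Open-reduces-AllZero oV in
      Reduces-interleave∞ (L₁ L) L (L₁-splits L) AllZero-resp-≗ (L∞-hard A dA) h-lip h-red B⇔

  coDifference-reduces-L₂ : ∀ {Γ L X} → (∀ B → Γ B → Reduces B (OmegaPower L)) →
    CoDifferenceDecomposition Γ X → Reduces X (OmegaPower (L₂ L))
  coDifference-reduces-L₂ {L = L} L∞-hard (A , U , V , dA , oU , oV , V⊆U , X⇔) =
    let (h , h-lip , h-red) = coDifference-reduces-Q₂ oU oV V⊆U in
    Reduces-interleave∞ (L₂ L) L (L₂-splits cl L) Q₂-resp-≗ (L∞-hard A dA) h-lip h-red X⇔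

  L₂-complete : ∀ {ζ L} → Complete (Dˇ ζ) (OmegaPower L) → Complete (Dˇ (suc (suc ζ))) (OmegaPower (L₂ L))
  L₂-complete {L = L} (L∞∈ , L∞-hard) =
    Dˇ-resp (λ α → ⇔-sym (⇔-trans (L₂-splits cl L α) (⇔-refl ×-⇔ Q₂⇔¬exactlyOne (odds∞ α))))
      (Dˇ-∩-coDifference (Dˇ-preimage evens∞-continuous L∞∈) (Open-odds∞ SomeOne-open) (Open-odds∞ TwoOnes-open)) ,
    λ B dB → coDifference-reduces-L₂ L∞-hard (Dˇ-suc-suc-decompose dB)

  L₂-complete-⊕ : ∀ {ζ L} → ζ % 2 ≡ 1 → Complete (D ζ ⊕ Dˇ ζ) (OmegaPower L) →
    Complete (D (suc (suc ζ)) ⊕ Dˇ (suc (suc ζ))) (OmegaPower (L₂ L))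
  L₂-complete-⊕ {ζ} {L} ζ-odd (L∞∈ , L∞-hard) = membership L∞∈ ,
    λ X (C , A , B , clopen , dA , dB , X⇔) →
      coDifference-reduces-L₂ L∞-hard
        (⊕-decompose clopen (D-suc-suc-decompose ζ-odd dA) (Dˇ-suc-suc-decompose dB) X⇔)
    where
    R : Pred
    R α = ¬ (SomeOne (odds∞ α) × ¬ TwoOnes (odds∞ α))
    oU : Open (λ α → SomeOne (odds∞ α))
    oU = Open-odds∞ SomeOne-open
    oV : Open (λ α → TwoOnes (odds∞ α))
    oV = Open-odds∞ TwoOnes-open
    membership : (D ζ ⊕ Dˇ ζ) (OmegaPower L) → (D (suc (suc ζ)) ⊕ Dˇ (suc (suc ζ))) (OmegaPower (L₂ L))
    membership (C , A , B , (oC , o¬C) , dA , dB , L∞⇔) =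
      (λ α → C (evens∞ α)) , (λ α → A (evens∞ α) × R α) , (λ α → B (evens∞ α) × R α) ,
      (Open-preimage evens∞-continuous oC , Open-preimage evens∞-continuous o¬C) ,
      D-∩-coDifference (D-preimage evens∞-continuous dA) oU oV ,
      Dˇ-∩-coDifference (Dˇ-preimage evens∞-continuous dB) oU oV ,
      λ α → ⇔-trans (L₂-splits cl L α)
              (⇔-trans (L∞⇔ (evens∞ α) ×-⇔ Q₂⇔¬exactlyOne (odds∞ α)) ×-⊎-distrib)

lemma3p4 : Classical → (k : ℕ) (L : Lang) →
      (Complete (Dˇ k) (OmegaPower L) → Complete (D (suc k)) (OmegaPower (L₀ L)))
    × (Complete (Dˇ (2 * k)) (OmegaPower L) → Complete (Dˇ (2 * k + 1)) (OmegaPower (L₁ L)))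
    × (Complete (Dˇ (2 * k)) (OmegaPower L) → Complete (Dˇ (2 * k + 2)) (OmegaPower (L₂ L)))
    × (Complete (D (2 * k + 1) ⊕ Dˇ (2 * k + 1)) (OmegaPower L)
       → Complete (D (2 * k + 3) ⊕ Dˇ (2 * k + 3)) (OmegaPower (L₂ L)))
lemma3p4 cl k L =
  L₀-complete cl ,
  (λ c → subst (λ ζ → Complete (Dˇ ζ) (OmegaPower (L₁ L))) (+-comm 1 (2 * k)) (L₁-complete cl 2k-even c)) ,
  (λ c → subst (λ ζ → Complete (Dˇ ζ) (OmegaPower (L₂ L))) (+-comm 2 (2 * k)) (L₂-complete cl c)) ,
  (λ c → subst (λ ζ → Complete (D ζ ⊕ Dˇ ζ) (OmegaPower (L₂ L))) 2k+3≡ (L₂-complete-⊕ cl 2k+1-odd c))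
  where
  2k-even : 2 * k % 2 ≡ 0
  2k-even = subst (λ n → n % 2 ≡ 0) (sym (2*≡double k)) (double-%2 k)
  2k+1-odd : (2 * k + 1) % 2 ≡ 1
  2k+1-odd = subst (λ n → n % 2 ≡ 1) (+-comm 1 (2 * k)) (suc-%2-of-even (2 * k) 2k-even)
  2k+3≡ : suc (suc (2 * k + 1)) ≡ 2 * k + 3
  2k+3≡ = trans (+-comm 2 (2 * k + 1)) (+-assoc (2 * k) 1 2)
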